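{- For all integers $a,b$ and all integers $c\geqslant 0$, \[H(a,b,c)=H(a+1,b+1,c-1)+(qt)^cH(a+c,b-c)+\sum_{i=0}^{c-1}(qt)^{b+2c-2i}H(a-b-2c+4i).\]
   Context: Let $q,t$ be indeterminates. A standard Young tableau $T$ with $n$ boxes is a bijective filling of the Young diagram of a partition of $n$ by $1,\dots,n$, increasing along rows (left to right) and columns (bottom to top); rows $r$ counted from the bottom, columns $c$ from the left, starting at $1$. Let $z_i=z_i(T)=q^{c-1}t^{r-1}$ where $i$ sits in row $r$, column $c$. Define \[\mathrm{wt}(T)=\prod_{i=2}^{n}\frac{1}{(1-z_i^{ -1})(1-qtz_{i-1}/z_i)}\prod_{1\leqslant i<j\leqslant n}\frac{(1-z_i/z_j)(1-qtz_i/z_j)}{(1-qz_i/z_j)(1-tz_i/z_j)},\] omitting any individual factor that vanishes. For integers $a_2,\dots,a_n$ define the rational function \[H(a_2,\dots,a_n)=\sum_{T:\ z_2(T)=q}z_2^{a_2}\cdots z_n^{a_n}(1-t/q)\mathrm{wt}(T),\] the sum over standard Young tableaux with $n$ boxes in which $2$ lies in row 1, column 2. Thus $H$ with three arguments uses $n=4$, with two arguments $n=3$, with one argument $n=2$. -}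

module Defs where

open import Data.Bool using (Bool; true; false; if_then_else_; _∧_)
open import Data.Nat as ℕ using (ℕ; zero; suc)
open import Data.Integer as ℤ using (ℤ; +_; -_)
open import Data.List using (List; []; _∷_; _++_; map; concatMap; foldr; zip; drop; filterᵇ; length; _∷ʳ_)
open import Data.Maybe using (Maybe; just; nothing)
open import Data.Product using (_×_; _,_; proj₁)
open import Relation.Nullary.Decidable using (⌊_⌋)
open import Relation.Binary.PropositionalEquality using (_≡_)

-- Laurent polynomials in q, t with integer coefficients, as formal
-- sums of terms  coef · q^i · t^j  (coef , i , j).

Term : Set
Term = ℤ × ℤ × ℤ

LPoly : Set
LPoly = List Term

0ᴾ : LPoly
0ᴾ = []

1ᴾ : LPoly
1ᴾ = (+ 1 , + 0 , + 0) ∷ []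

mono : ℤ → ℤ → LPoly
mono i j = (+ 1 , i , j) ∷ []

_+ᴾ_ : LPoly → LPoly → LPoly
p +ᴾ r = p ++ r

_*ᴾ_ : LPoly → LPoly → LPoly
p *ᴾ r = concatMap (λ { (a , i , j) → map (λ { (b , k , l) → (a ℤ.* b , i ℤ.+ k , j ℤ.+ l) }) r }) p

coeff : LPoly → ℤ → ℤ → ℤ
coeff [] k l = + 0
coeff ((a , i , j) ∷ p) k l =
  (if ⌊ i ℤ.≟ k ⌋ ∧ ⌊ j ℤ.≟ l ⌋ then a else + 0) ℤ.+ coeff p k l

_≈ᴾ_ : LPoly → LPoly → Set
p ≈ᴾ r = ∀ k l → coeff p k l ≡ coeff r k l

prodᴾ : List LPoly → LPoly
prodᴾ = foldr _*ᴾ_ 1ᴾ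

-- Rational functions in Q(q,t) as fractions num/den of Laurent
-- polynomials; equality by cross multiplication.

record RatFun : Set where
  constructor _/_
  field
    num den : LPoly
open RatFun public

0ᴿ : RatFun
0ᴿ = 0ᴾ / 1ᴾ

poly : LPoly → RatFun
poly p = p / 1ᴾ

_+ᴿ_ : RatFun → RatFun → RatFun
(n₁ / d₁) +ᴿ (n₂ / d₂) = ((n₁ *ᴾ d₂) +ᴾ (n₂ *ᴾ d₁)) / (d₁ *ᴾ d₂)

_*ᴿ_ : RatFun → RatFun → RatFun
(n₁ / d₁) *ᴿ (n₂ / d₂) = (n₁ *ᴾ n₂) / (d₁ *ᴾ d₂)

_≈ᴿ_ : RatFun → RatFun → Set
(n₁ / d₁) ≈ᴿ (n₂ / d₂) = (n₁ *ᴾ d₂) ≈ᴾ (n₂ *ᴾ d₁)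

infixl 6 _+ᴿ_
infixl 7 _*ᴿ_
infix 4 _≈ᴿ_ _≈ᴾ_

sumᴿ : List RatFun → RatFun
sumᴿ = foldr _+ᴿ_ 0ᴿ

Σᴿ : ℕ → (ℕ → RatFun) → RatFun
Σᴿ zero f = 0ᴿ
Σᴿ (suc c) f = Σᴿ c f +ᴿ f c

-- Standard Young tableaux, as the sequence of cells occupied by
-- 1, 2, ..., n; cells are (row , column), 0-indexed from the bottom
-- left.  A filling is standard iff each initial segment is a Young
-- diagram, i.e. each new entry is placed in an addable corner.

Cell : Set
Cell = ℕ × ℕ

-- a shape is the list of row lengths, bottom row first
Shape : Set
Shape = List ℕ

private
  canAdd : Maybe ℕ → ℕ → Bool
  canAdd nothing  l = true
  canAdd (just p) l = l ℕ.<ᵇ p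

  addGo : Maybe ℕ → ℕ → Shape → List (Cell × Shape)
  addGo prev r [] = ((r , 0) , 1 ∷ []) ∷ []
  addGo prev r (l ∷ ls) =
    (if canAdd prev l then ((r , l) , suc l ∷ ls) ∷ [] else [])
    ++ map (λ { (c , s) → (c , l ∷ s) }) (addGo (just l) (suc r) ls)

addable : Shape → List (Cell × Shape)
addable = addGo nothing 0

grow : ℕ → List (List Cell × Shape)
grow zero = ([] , []) ∷ []
grow (suc n) =
  concatMap (λ { (cs , sh) → map (λ { (c , sh') → (cs ∷ʳ c , sh') }) (addable sh) }) (grow n)

SYT : ℕ → List (List Cell)
SYT n = map proj₁ (grow n)

Exp : Set
Exp = ℤ × ℤ

-- exponent of z = q^(c-1) t^(r-1) (1-indexed), i.e. q^col t^row here
zExp : Cell → Exp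
zExp (r , c) = (+ c , + r)

-- the factor 1 - q^a t^b, omitted (replaced by 1) when it vanishes
fac : Exp → LPoly
fac (a , b) = if ⌊ a ℤ.≟ + 0 ⌋ ∧ ⌊ b ℤ.≟ + 0 ⌋ then 1ᴾ
              else (+ 1 , + 0 , + 0) ∷ (ℤ.- + 1 , a , b) ∷ []

pairsLt : {A : Set} → List A → List (A × A)
pairsLt [] = []
pairsLt (x ∷ xs) = map (x ,_) xs ++ pairsLt xs

wt : List Cell → RatFun
wt T = prodᴾ (map numPair (pairsLt zs)) / (prodᴾ (map denCons (zip zs (drop 1 zs))) *ᴾ prodᴾ (map denPair (pairsLt zs)))
  where
  zs : List Exp
  zs = map zExp T
  -- (z_{i-1}, z_i): (1 - z_i^{-1}) (1 - q t z_{i-1}/z_i)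
  denCons : Exp × Exp → LPoly
  denCons ((u₁ , u₂) , (v₁ , v₂)) = fac (ℤ.- v₁ , ℤ.- v₂) *ᴾ fac (+ 1 ℤ.+ u₁ ℤ.- v₁ , + 1 ℤ.+ u₂ ℤ.- v₂)
  -- (z_i, z_j), i<j: (1 - z_i/z_j)(1 - q t z_i/z_j)
  numPair : Exp × Exp → LPoly
  numPair ((u₁ , u₂) , (v₁ , v₂)) = fac (u₁ ℤ.- v₁ , u₂ ℤ.- v₂) *ᴾ fac (+ 1 ℤ.+ u₁ ℤ.- v₁ , + 1 ℤ.+ u₂ ℤ.- v₂)
  -- (1 - q z_i/z_j)(1 - t z_i/z_j)
  denPair : Exp × Exp → LPoly
  denPair ((u₁ , u₂) , (v₁ , v₂)) = fac (+ 1 ℤ.+ u₁ ℤ.- v₁ , u₂ ℤ.- v₂) *ᴾ fac (u₁ ℤ.- v₁ , + 1 ℤ.+ u₂ ℤ.- v₂)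

-- is 2 in row 1, column 2 (i.e. z_2 = q)?
twoAtq : List Cell → Bool
twoAtq (_ ∷ (0 , 1) ∷ _) = true
twoAtq _ = false

-- z_2^{a_2} ... z_n^{a_n}, given the exponents a_2..a_n and the cells of 2..n
zPow : List ℤ → List Cell → LPoly
zPow as cs = go as cs (+ 0) (+ 0)
  where
  go : List ℤ → List Cell → ℤ → ℤ → LPoly
  go (a ∷ as) ((r , c) ∷ cs) i j = go as cs (i ℤ.+ a ℤ.* + c) (j ℤ.+ a ℤ.* + r)
  go _ _ i j = mono i j

oneMinusTOverQ : LPoly
oneMinusTOverQ = (+ 1 , + 0 , + 0) ∷ (ℤ.- + 1 , ℤ.- + 1 , + 1) ∷ []

-- H(a_2,...,a_n), with n = 1 + (number of arguments)
H : List ℤ → RatFun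
H as = sumᴿ (map term (filterᵇ twoAtq (SYT (suc (length as)))))
  where
  term : List Cell → RatFun
  term T = poly (zPow as (drop 1 T)) *ᴿ poly oneMinusTOverQ *ᴿ wt T

qtPow : ℤ → RatFun
qtPow k = poly (mono k k)

-- Only one, two and five standard Young tableaux with 2, 3 and 4 boxes have 2 in the cell (1,2),
-- so every H occurring here is an explicit sum of monomials z₂^a₂ ⋯ z_n^a_n times the weights
-- (1 - t/q) wt(T).  After cancelling the factors common to numerator and denominator each weight
-- keeps at most one factor 1 - q^i t^j above and three below.  The shift (a, b, c) ↦
-- (a + 1, b + 1, c - 1) multiplies the monomials of three of the five four-box tableaux by q³/t,
-- t/q and q/t; three identities between weights turn the differences into (qt)^c H(a + c, b - c)
-- plus (q^a t^(b+2c) - q^(a+2c) t^b)/(1 - q²/t²), which is the geometric sum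
-- Σ_{i<c} q^(a+2i) t^(b+2c-2i).
--
-- Rational functions are fractions compared by cross-multiplication.  One may compute with them
-- as in a field of fractions because every denominator is a product of factors 1 - q^i t^j, and
-- these are non-zero-divisors: (1 - q^i t^j) r = 0 makes the coefficients of r periodic, and a
-- periodic function of finite support vanishes.

module Submission where

open import Defs
open import Algebra.Bundles using (CommutativeRing)
open import Algebra.Structures using (IsCommutativeRing)
import Algebra.Solver.Ring
open import Algebra.Solver.Ring.AlmostCommutativeRing using (fromCommutativeRing; _-Raw-AlmostCommutative⟶_)
open import Data.Bool using (Bool; true; false; if_then_else_; _∧_) renaming (T to IsTrue)
open import Data.Integer
  using (ℤ; +_; -[1+_]; +[1+_]; 0ℤ; _+_; _-_; _*_; -_; _≟_; _≤_; _⊓_; ∣_∣; +≤+; -≤+; +<+)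
import Data.Integer.Base as ℤ using (+-*-rawRing)
import Data.Integer.Properties as ℤ
open import Data.Integer.Tactic.RingSolver as ℤ-Solver using (solve-∀)
open import Data.List using (List; []; _∷_; _++_; map; concatMap; zip; drop; filterᵇ; length; foldr)
open import Data.List.Properties using (++-assoc; ++-identityʳ)
open import Data.List.Relation.Binary.Permutation.Propositional as ↭ using (_↭_; ↭-sym; prep; swap)
open import Data.List.Relation.Unary.All as All using (All; all?)
open import Data.List.Relation.Unary.All.Properties using (¬Any⇒All¬)
open import Data.List.Relation.Unary.Any using (Any; here; there; any?)
open import Data.Maybe as Maybe using (Maybe; just; nothing; is-just; to-witness-T)
open import Data.Nat using (ℕ; zero; suc; z≤n; s≤s)
import Data.Nat.Properties as ℕ
open import Data.Product using (_×_; _,_; ∃-syntax)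
open import Data.Product.Properties using (≡-dec)
open import Level using (0ℓ)
open import Relation.Binary.PropositionalEquality
open import Relation.Binary.Structures using (IsEquivalence)
import Relation.Binary.Reasoning.Setoid as SetoidReasoning
open import Relation.Nullary using (¬_; Dec; contradiction)
open import Relation.Nullary.Decidable using (⌊_⌋; yes; no; True; toWitness; recompute)

coeffₜ : Term → ℤ → ℤ → ℤ
coeffₜ (a , i , j) k l = if ⌊ i ≟ k ⌋ ∧ ⌊ j ≟ l ⌋ then a else 0ℤ

_·ₜ_ : Term → Term → Term
(a , i , j) ·ₜ (b , k , l) = (a * b , i + k , j + l)

coeff-++ : ∀ p r k l → coeff (p ++ r) k l ≡ coeff p k l + coeff r k l
coeff-++ []      r k l = sym (ℤ.+-identityˡ _)
coeff-++ (x ∷ p) r k l rewrite coeff-++ p r k l = sym (ℤ.+-assoc (coeffₜ x k l) _ _)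

⌊+≟⌋≡⌊≟-⌋ : ∀ i i′ k → ⌊ i + i′ ≟ k ⌋ ≡ ⌊ i′ ≟ k - i ⌋
⌊+≟⌋≡⌊≟-⌋ i i′ k with i + i′ ≟ k | i′ ≟ k - i
... | yes _  | yes _  = refl
... | no  _  | no  _  = refl
... | yes eq | no ne  = contradiction (trans (sym (lem i i′)) (cong (_- i) eq)) ne
  where lem : ∀ i i′ → (i + i′) - i ≡ i′
        lem = solve-∀
... | no ne  | yes eq = contradiction (trans (cong (λ z → i + z) eq) (lem i k)) ne
  where lem : ∀ i k → i + (k - i) ≡ k
        lem = solve-∀

*-distrib-if : ∀ (c : Bool) a b → (if c then a * b else 0ℤ) ≡ a * (if c then b else 0ℤ)
*-distrib-if true  a b = refl
*-distrib-if false a b = sym (ℤ.*-zeroʳ a)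

coeffₜ-·ₜ : ∀ a i j y k l → coeffₜ ((a , i , j) ·ₜ y) k l ≡ a * coeffₜ y (k - i) (l - j)
coeffₜ-·ₜ a i j (b , i′ , j′) k l rewrite ⌊+≟⌋≡⌊≟-⌋ i i′ k | ⌊+≟⌋≡⌊≟-⌋ j j′ l = *-distrib-if _ a b

·ₜ-comm : ∀ x y → x ·ₜ y ≡ y ·ₜ x
·ₜ-comm (a , i , j) (b , i′ , j′) rewrite ℤ.*-comm a b | ℤ.+-comm i i′ | ℤ.+-comm j j′ = refl

coeff-map-·ₜ : ∀ a i j r k l → coeff (map ((a , i , j) ·ₜ_) r) k l ≡ a * coeff r (k - i) (l - j)
coeff-map-·ₜ a i j []      k l = sym (ℤ.*-zeroʳ a)
coeff-map-·ₜ a i j (y ∷ r) k l rewrite coeffₜ-·ₜ a i j y k l | coeff-map-·ₜ a i j r k l =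
  sym (ℤ.*-distribˡ-+ a (coeffₜ y (k - i) (l - j)) _)

coeff-*ᴾ-∷ˡ : ∀ a i j p r k l →
  coeff (((a , i , j) ∷ p) *ᴾ r) k l ≡ a * coeff r (k - i) (l - j) + coeff (p *ᴾ r) k l
coeff-*ᴾ-∷ˡ a i j p r k l =
  trans (coeff-++ (map ((a , i , j) ·ₜ_) r) (p *ᴾ r) k l)
        (cong (λ z → z + coeff (p *ᴾ r) k l) (coeff-map-·ₜ a i j r k l))

coeff-*ᴾ-[]ʳ : ∀ p k l → coeff (p *ᴾ []) k l ≡ 0ℤ
coeff-*ᴾ-[]ʳ []                k l = refl
coeff-*ᴾ-[]ʳ ((a , i , j) ∷ p) k l
  rewrite coeff-*ᴾ-∷ˡ a i j p [] k l | coeff-*ᴾ-[]ʳ p k l | ℤ.*-zeroʳ a = refl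

coeff-*ᴾ-∷ʳ : ∀ b i j p r k l →
  coeff (p *ᴾ ((b , i , j) ∷ r)) k l ≡ b * coeff p (k - i) (l - j) + coeff (p *ᴾ r) k l
coeff-*ᴾ-∷ʳ b i j []                  r k l = sym (trans (ℤ.+-identityʳ _) (ℤ.*-zeroʳ b))
coeff-*ᴾ-∷ʳ b i j ((a , i′ , j′) ∷ p) r k l = begin
  coeff (((a , i′ , j′) ∷ p) *ᴾ ((b , i , j) ∷ r)) k l
    ≡⟨ coeff-*ᴾ-∷ˡ a i′ j′ p _ k l ⟩
  a * (X + Y) + coeff (p *ᴾ ((b , i , j) ∷ r)) k l
    ≡⟨ cong (λ z → a * (X + Y) + z) (coeff-*ᴾ-∷ʳ b i j p r k l) ⟩
  a * (X + Y) + (b * P + W)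
    ≡⟨ regroup a b X Y P W ⟩
  a * X + b * P + (a * Y + W)
    ≡⟨ cong (λ z → z + b * P + (a * Y + W)) same-contribution ⟩
  b * X′ + b * P + (a * Y + W)
    ≡⟨ cong (λ z → z + (a * Y + W)) (sym (ℤ.*-distribˡ-+ b X′ P)) ⟩
  b * (X′ + P) + (a * Y + W)
    ≡⟨ cong (λ z → b * (X′ + P) + z) (sym (coeff-*ᴾ-∷ˡ a i′ j′ p r k l)) ⟩
  b * coeff ((a , i′ , j′) ∷ p) (k - i) (l - j) + coeff (((a , i′ , j′) ∷ p) *ᴾ r) k l ∎
  where
  open ≡-Reasoning
  X  = coeffₜ (b , i , j) (k - i′) (l - j′)
  X′ = coeffₜ (a , i′ , j′) (k - i) (l - j)
  Y  = coeff r (k - i′) (l - j′)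
  P  = coeff p (k - i) (l - j)
  W  = coeff (p *ᴾ r) k l
  regroup : ∀ a b X Y P W → a * (X + Y) + (b * P + W) ≡ a * X + b * P + (a * Y + W)
  regroup = solve-∀
  same-contribution : a * X ≡ b * X′
  same-contribution = begin
    a * X                                     ≡⟨ sym (coeffₜ-·ₜ a i′ j′ (b , i , j) k l) ⟩
    coeffₜ ((a , i′ , j′) ·ₜ (b , i , j)) k l ≡⟨ cong (λ x → coeffₜ x k l) (·ₜ-comm (a , i′ , j′) (b , i , j)) ⟩
    coeffₜ ((b , i , j) ·ₜ (a , i′ , j′)) k l ≡⟨ coeffₜ-·ₜ b i j (a , i′ , j′) k l ⟩
    b * X′                                    ∎

coeff-*ᴾ-comm : ∀ p r k l → coeff (p *ᴾ r) k l ≡ coeff (r *ᴾ p) k l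
coeff-*ᴾ-comm []                r k l = sym (coeff-*ᴾ-[]ʳ r k l)
coeff-*ᴾ-comm ((a , i , j) ∷ p) r k l = begin
  coeff (((a , i , j) ∷ p) *ᴾ r) k l                ≡⟨ coeff-*ᴾ-∷ˡ a i j p r k l ⟩
  a * coeff r (k - i) (l - j) + coeff (p *ᴾ r) k l  ≡⟨ cong (λ z → a * coeff r (k - i) (l - j) + z) (coeff-*ᴾ-comm p r k l) ⟩
  a * coeff r (k - i) (l - j) + coeff (r *ᴾ p) k l  ≡⟨ sym (coeff-*ᴾ-∷ʳ a i j r p k l) ⟩
  coeff (r *ᴾ ((a , i , j) ∷ p)) k l                ∎
  where open ≡-Reasoning

*ᴾ-distribʳ-++ : ∀ p q r → (p ++ q) *ᴾ r ≡ (p *ᴾ r) ++ (q *ᴾ r)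
*ᴾ-distribʳ-++ []      q r = refl
*ᴾ-distribʳ-++ (x ∷ p) q r =
  trans (cong (map (x ·ₜ_) r ++_) (*ᴾ-distribʳ-++ p q r)) (sym (++-assoc (map (x ·ₜ_) r) _ _))

coeff-map-·ₜ-*ᴾ : ∀ a i j q r k l →
  coeff (map ((a , i , j) ·ₜ_) q *ᴾ r) k l ≡ a * coeff (q *ᴾ r) (k - i) (l - j)
coeff-map-·ₜ-*ᴾ a i j []                  r k l = sym (ℤ.*-zeroʳ a)
coeff-map-·ₜ-*ᴾ a i j ((b , i′ , j′) ∷ q) r k l = begin
  coeff (map ((a , i , j) ·ₜ_) ((b , i′ , j′) ∷ q) *ᴾ r) k l
    ≡⟨ coeff-*ᴾ-∷ˡ (a * b) (i + i′) (j + j′) (map ((a , i , j) ·ₜ_) q) r k l ⟩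
  a * b * coeff r (k - (i + i′)) (l - (j + j′)) + S
    ≡⟨ cong₂ (λ u v → a * b * coeff r u v + S) (sub-+ k i i′) (sub-+ l j j′) ⟩
  a * b * coeff r (k - i - i′) (l - j - j′) + S
    ≡⟨ cong (λ z → a * b * coeff r (k - i - i′) (l - j - j′) + z) (coeff-map-·ₜ-*ᴾ a i j q r k l) ⟩
  a * b * coeff r (k - i - i′) (l - j - j′) + a * coeff (q *ᴾ r) (k - i) (l - j)
    ≡⟨ factor a b _ _ ⟩
  a * (b * coeff r (k - i - i′) (l - j - j′) + coeff (q *ᴾ r) (k - i) (l - j))
    ≡⟨ cong (a *_) (sym (coeff-*ᴾ-∷ˡ b i′ j′ q r (k - i) (l - j))) ⟩
  a * coeff (((b , i′ , j′) ∷ q) *ᴾ r) (k - i) (l - j) ∎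
  where
  open ≡-Reasoning
  S = coeff (map ((a , i , j) ·ₜ_) q *ᴾ r) k l
  sub-+ : ∀ k i i′ → k - (i + i′) ≡ k - i - i′
  sub-+ = solve-∀
  factor : ∀ a b x y → a * b * x + a * y ≡ a * (b * x + y)
  factor = solve-∀

coeff-*ᴾ-assoc : ∀ p q r k l → coeff ((p *ᴾ q) *ᴾ r) k l ≡ coeff (p *ᴾ (q *ᴾ r)) k l
coeff-*ᴾ-assoc []                q r k l = refl
coeff-*ᴾ-assoc ((a , i , j) ∷ p) q r k l = begin
  coeff ((map ((a , i , j) ·ₜ_) q ++ (p *ᴾ q)) *ᴾ r) k l
    ≡⟨ cong (λ s → coeff s k l) (*ᴾ-distribʳ-++ (map ((a , i , j) ·ₜ_) q) (p *ᴾ q) r) ⟩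
  coeff ((map ((a , i , j) ·ₜ_) q *ᴾ r) ++ ((p *ᴾ q) *ᴾ r)) k l
    ≡⟨ coeff-++ (map ((a , i , j) ·ₜ_) q *ᴾ r) _ k l ⟩
  coeff (map ((a , i , j) ·ₜ_) q *ᴾ r) k l + coeff ((p *ᴾ q) *ᴾ r) k l
    ≡⟨ cong₂ _+_ (coeff-map-·ₜ-*ᴾ a i j q r k l) (coeff-*ᴾ-assoc p q r k l) ⟩
  a * coeff (q *ᴾ r) (k - i) (l - j) + coeff (p *ᴾ (q *ᴾ r)) k l
    ≡⟨ sym (coeff-*ᴾ-∷ˡ a i j p (q *ᴾ r) k l) ⟩
  coeff (((a , i , j) ∷ p) *ᴾ (q *ᴾ r)) k l ∎
  where open ≡-Reasoning

infix 25 -ᴾ_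
-ᴾ_ : LPoly → LPoly
-ᴾ_ = map λ { (a , i , j) → (- a , i , j) }

coeff--ᴾ : ∀ p k l → coeff (-ᴾ p) k l ≡ - coeff p k l
coeff--ᴾ []                k l = refl
coeff--ᴾ ((a , i , j) ∷ p) k l rewrite coeff--ᴾ p k l =
  trans (cong (_+ - coeff p k l) (neg-if (⌊ i ≟ k ⌋ ∧ ⌊ j ≟ l ⌋)))
        (sym (ℤ.neg-distrib-+ (coeffₜ (a , i , j) k l) (coeff p k l)))
  where
  neg-if : ∀ c → (if c then - a else 0ℤ) ≡ - (if c then a else 0ℤ)
  neg-if true  = refl
  neg-if false = refl

coeff-*ᴾ-identityˡ : ∀ p k l → coeff (1ᴾ *ᴾ p) k l ≡ coeff p k l
coeff-*ᴾ-identityˡ p k l = begin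
  coeff (1ᴾ *ᴾ p) k l                    ≡⟨ coeff-*ᴾ-∷ˡ (+ 1) 0ℤ 0ℤ [] p k l ⟩
  + 1 * coeff p (k - 0ℤ) (l - 0ℤ) + 0ℤ  ≡⟨ ℤ.+-identityʳ _ ⟩
  + 1 * coeff p (k - 0ℤ) (l - 0ℤ)       ≡⟨ ℤ.*-identityˡ _ ⟩
  coeff p (k - 0ℤ) (l - 0ℤ)             ≡⟨ cong₂ (coeff p) (ℤ.+-identityʳ k) (ℤ.+-identityʳ l) ⟩
  coeff p k l                           ∎
  where open ≡-Reasoning

-- _≈ᴾ_ as a record, so that both polynomials can be inferred from a proof.
infix 4 _≋_
record _≋_ (p r : LPoly) : Set where
  constructor coeffs
  field coeff-≡ : p ≈ᴾ r
open _≋_ public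

≋-isEquivalence : IsEquivalence _≋_
≋-isEquivalence = record
  { refl  = coeffs λ _ _ → refl
  ; sym   = λ p≋r → coeffs λ k l → sym (coeff-≡ p≋r k l)
  ; trans = λ p≋r r≋s → coeffs λ k l → trans (coeff-≡ p≋r k l) (coeff-≡ r≋s k l)
  }

open IsEquivalence ≋-isEquivalence
  using () renaming (refl to ≋-refl; sym to ≋-sym; trans to ≋-trans; reflexive to ≋-reflexive)

+ᴾ-cong : ∀ {p p′ r r′} → p ≋ p′ → r ≋ r′ → p +ᴾ r ≋ p′ +ᴾ r′
+ᴾ-cong {p} {p′} {r} {r′} p≋p′ r≋r′ = coeffs λ k l → begin
  coeff (p ++ r) k l          ≡⟨ coeff-++ p r k l ⟩
  coeff p k l + coeff r k l   ≡⟨ cong₂ _+_ (coeff-≡ p≋p′ k l) (coeff-≡ r≋r′ k l) ⟩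
  coeff p′ k l + coeff r′ k l ≡⟨ sym (coeff-++ p′ r′ k l) ⟩
  coeff (p′ ++ r′) k l        ∎
  where open ≡-Reasoning

*ᴾ-congˡ : ∀ p {r r′} → r ≋ r′ → p *ᴾ r ≋ p *ᴾ r′
*ᴾ-congˡ []                r≋r′ = coeffs λ _ _ → refl
*ᴾ-congˡ ((a , i , j) ∷ p) {r} {r′} r≋r′ = coeffs λ k l → begin
  coeff (((a , i , j) ∷ p) *ᴾ r) k l                  ≡⟨ coeff-*ᴾ-∷ˡ a i j p r k l ⟩
  a * coeff r (k - i) (l - j) + coeff (p *ᴾ r) k l
    ≡⟨ cong₂ (λ u v → a * u + v) (coeff-≡ r≋r′ (k - i) (l - j)) (coeff-≡ (*ᴾ-congˡ p r≋r′) k l) ⟩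
  a * coeff r′ (k - i) (l - j) + coeff (p *ᴾ r′) k l  ≡⟨ sym (coeff-*ᴾ-∷ˡ a i j p r′ k l) ⟩
  coeff (((a , i , j) ∷ p) *ᴾ r′) k l                 ∎
  where open ≡-Reasoning

*ᴾ-comm : ∀ p r → p *ᴾ r ≋ r *ᴾ p
*ᴾ-comm p r = coeffs (coeff-*ᴾ-comm p r)

*ᴾ-cong : ∀ {p p′ r r′} → p ≋ p′ → r ≋ r′ → p *ᴾ r ≋ p′ *ᴾ r′
*ᴾ-cong {p} {p′} {r} {r′} p≋p′ r≋r′ = coeffs λ k l → begin
  coeff (p *ᴾ r) k l   ≡⟨ coeff-≡ (*ᴾ-congˡ p r≋r′) k l ⟩
  coeff (p *ᴾ r′) k l  ≡⟨ coeff-*ᴾ-comm p r′ k l ⟩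
  coeff (r′ *ᴾ p) k l  ≡⟨ coeff-≡ (*ᴾ-congˡ r′ p≋p′) k l ⟩
  coeff (r′ *ᴾ p′) k l ≡⟨ coeff-*ᴾ-comm r′ p′ k l ⟩
  coeff (p′ *ᴾ r′) k l ∎
  where open ≡-Reasoning

-ᴾ‿cong : ∀ {p r} → p ≋ r → -ᴾ p ≋ -ᴾ r
-ᴾ‿cong {p} {r} p≋r = coeffs λ k l →
  trans (coeff--ᴾ p k l) (trans (cong -_ (coeff-≡ p≋r k l)) (sym (coeff--ᴾ r k l)))

*ᴾ-distribʳ : ∀ p q r → (q +ᴾ r) *ᴾ p ≋ (q *ᴾ p) +ᴾ (r *ᴾ p)
*ᴾ-distribʳ p q r = coeffs λ k l → cong (λ t → coeff t k l) (*ᴾ-distribʳ-++ q r p)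

LPoly-isCommutativeRing : IsCommutativeRing _≋_ _+ᴾ_ _*ᴾ_ -ᴾ_ 0ᴾ 1ᴾ
LPoly-isCommutativeRing = record
  { isRing = record
    { +-isAbelianGroup = record
      { isGroup = record
        { isMonoid = record
          { isSemigroup = record
            { isMagma = record { isEquivalence = ≋-isEquivalence ; ∙-cong = +ᴾ-cong }
            ; assoc   = λ p r s → coeffs λ k l → cong (λ t → coeff t k l) (++-assoc p r s) }
          ; identity = (λ p → coeffs λ _ _ → refl)
                     , (λ p → coeffs λ k l → cong (λ t → coeff t k l) (++-identityʳ p)) }
        ; inverse = (λ p → coeffs λ k l → trans (coeff-++ (-ᴾ p) p k l)
                      (trans (cong (_+ coeff p k l) (coeff--ᴾ p k l)) (ℤ.+-inverseˡ (coeff p k l))))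
                  , (λ p → coeffs λ k l → trans (coeff-++ p (-ᴾ p) k l)
                      (trans (cong (λ z → coeff p k l + z) (coeff--ᴾ p k l)) (ℤ.+-inverseʳ (coeff p k l))))
        ; ⁻¹-cong = -ᴾ‿cong }
      ; comm = λ p r → coeffs λ k l →
          trans (coeff-++ p r k l) (trans (ℤ.+-comm (coeff p k l) _) (sym (coeff-++ r p k l))) }
    ; *-cong     = *ᴾ-cong
    ; *-assoc    = λ p q r → coeffs (coeff-*ᴾ-assoc p q r)
    ; *-identity = (λ p → coeffs (coeff-*ᴾ-identityˡ p))
                 , (λ p → coeffs λ k l → trans (coeff-*ᴾ-comm p 1ᴾ k l) (coeff-*ᴾ-identityˡ p k l))
    ; distrib    = (λ p q r → coeffs λ k l → trans (coeff-*ᴾ-comm p (q ++ r) k l)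
                      (coeff-≡ (≋-trans (*ᴾ-distribʳ p q r) (+ᴾ-cong (*ᴾ-comm q p) (*ᴾ-comm r p))) k l))
                 , *ᴾ-distribʳ }
  ; *-comm = *ᴾ-comm
  }

LPoly-commutativeRing : CommutativeRing 0ℓ 0ℓ
LPoly-commutativeRing = record { isCommutativeRing = LPoly-isCommutativeRing }

module ≋-Reasoning = SetoidReasoning (CommutativeRing.setoid LPoly-commutativeRing)

constᴾ : ℤ → LPoly
constᴾ a = (a , 0ℤ , 0ℤ) ∷ []

constᴾ-homomorphism : ℤ.+-*-rawRing -Raw-AlmostCommutative⟶ fromCommutativeRing LPoly-commutativeRing
constᴾ-homomorphism = record
  { ⟦_⟧    = constᴾ
  ; +-homo = λ a b → coeffs λ k l → +-homo a b (⌊ 0ℤ ≟ k ⌋ ∧ ⌊ 0ℤ ≟ l ⌋)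
  ; *-homo = λ _ _ → coeffs λ _ _ → refl
  ; -‿homo = λ _ → coeffs λ _ _ → refl
  ; 0-homo = coeffs λ k l → 0-homo (⌊ 0ℤ ≟ k ⌋ ∧ ⌊ 0ℤ ≟ l ⌋)
  ; 1-homo = coeffs λ _ _ → refl
  }
  where
  +-homo : ∀ a b c → (if c then a + b else 0ℤ) + 0ℤ ≡ (if c then a else 0ℤ) + ((if c then b else 0ℤ) + 0ℤ)
  +-homo a b true  = trans (ℤ.+-identityʳ _) (cong (λ z → a + z) (sym (ℤ.+-identityʳ b)))
  +-homo a b false = refl
  0-homo : ∀ c → (if c then 0ℤ else 0ℤ) + 0ℤ ≡ 0ℤ
  0-homo true  = refl
  0-homo false = refl

constᴾ-≟ : ∀ a b → Maybe (constᴾ a ≋ constᴾ b)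
constᴾ-≟ a b with a ≟ b
... | yes refl = just ≋-refl
... | no  _    = nothing

module LPoly-Solver = Algebra.Solver.Ring ℤ.+-*-rawRing (fromCommutativeRing LPoly-commutativeRing)
                        constᴾ-homomorphism constᴾ-≟

-- Non-zero-divisors

AllExponents : (ℤ → ℤ → Set) → LPoly → Set
AllExponents P = All λ { (_ , i , j) → P i j }

coeff-outside : (P : ℤ → ℤ → Set) → ∀ p → AllExponents P p → ∀ {k l} → ¬ P k l → coeff p k l ≡ 0ℤ
coeff-outside P []                All.[]          ¬P = refl
coeff-outside P ((a , i , j) ∷ p) (Pij All.∷ Pp) {k} {l} ¬P with i ≟ k | j ≟ l
... | yes refl | yes refl = contradiction Pij ¬P
... | yes _    | no  _    = trans (ℤ.+-identityˡ _) (coeff-outside P p Pp ¬P)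
... | no  _    | _        = trans (ℤ.+-identityˡ _) (coeff-outside P p Pp ¬P)

exponents-bounded-below : (φ : ℤ → ℤ → ℤ) → ∀ p → ∃[ B ] AllExponents (λ i j → B ≤ φ i j) p
exponents-bounded-below φ []                = 0ℤ , All.[]
exponents-bounded-below φ ((a , i , j) ∷ p) with exponents-bounded-below φ p
... | B , B≤ = B ⊓ φ i j , ℤ.i⊓j≤j B (φ i j) All.∷ All.map (ℤ.≤-trans (ℤ.i⊓j≤i B (φ i j))) B≤

iterate-period : ∀ {i j} r → (∀ k l → coeff r k l ≡ coeff r (k - i) (l - j)) →
                 ∀ n k l → coeff r k l ≡ coeff r (k - + n * i) (l - + n * j)
iterate-period r period zero    k l = sym (cong₂ (coeff r) (ℤ.+-identityʳ k) (ℤ.+-identityʳ l))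
iterate-period {i} {j} r period (suc n) k l =
  trans (iterate-period r period n k l) (trans (period _ _) (cong₂ (coeff r) (step k i (+ n)) (step l j (+ n))))
  where
  step : ∀ k i N → k - N * i - i ≡ k - (+ 1 + N) * i
  step = solve-∀

i≤+∣i∣ : ∀ i → i ≤ + ∣ i ∣
i≤+∣i∣ (+ n)    = ℤ.≤-refl
i≤+∣i∣ -[1+ n ] = -≤+

square-nonNeg : ∀ i → 0ℤ ≤ i * i
square-nonNeg (+ zero) = ℤ.≤-refl
square-nonNeg +[1+ n ] = +≤+ z≤n
square-nonNeg -[1+ n ] = +≤+ z≤n

square-pos : ∀ i → i ≢ 0ℤ → + 1 ≤ i * i
square-pos (+ zero) i≢0 = contradiction refl i≢0
square-pos +[1+ n ] _   = +≤+ (s≤s z≤n)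
square-pos -[1+ n ] _   = +≤+ (s≤s z≤n)

sum-of-squares-pos : ∀ {i j} → ¬ (i ≡ 0ℤ × j ≡ 0ℤ) → + 1 ≤ i * i + j * j
sum-of-squares-pos {i} {j} ¬0 with i ≟ 0ℤ | j ≟ 0ℤ
... | yes refl | yes refl = contradiction (refl , refl) ¬0
... | no  i≢0  | _        = ℤ.+-mono-≤ (square-pos i i≢0) (square-nonNeg j)
... | yes refl | no  j≢0  = ℤ.+-mono-≤ (square-nonNeg 0ℤ) (square-pos j j≢0)

-- φ k l = i k + j l drops by i² + j² > 0 with every period, so far enough along the orbit
-- of (k , l) it is below every exponent of r.
periodic⇒coeff≡0 : ∀ {i j} → ¬ (i ≡ 0ℤ × j ≡ 0ℤ) → ∀ r →
                   (∀ k l → coeff r k l ≡ coeff r (k - i) (l - j)) → ∀ k l → coeff r k l ≡ 0ℤ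
periodic⇒coeff≡0 {i} {j} ¬0 r period k l with exponents-bounded-below (λ k l → i * k + j * l) r
... | B , B≤ = trans (iterate-period r period n k l) (coeff-outside (λ k l → B ≤ φ k l) r B≤ below)
  where
  φ : ℤ → ℤ → ℤ
  φ k l = i * k + j * l
  s = i * i + j * j
  n = suc ∣ φ k l - B ∣
  N = + n
  shift : φ (k - N * i) (l - N * j) + N * s ≡ φ k l
  shift = lem i j k l N
    where lem : ∀ i j k l N → i * (k - N * i) + j * (l - N * j) + N * (i * i + j * j) ≡ i * k + j * l
          lem = solve-∀
  below : ¬ (B ≤ φ (k - N * i) (l - N * j))
  below B≤φ = ℤ.<-irrefl refl (begin-strict
    B + N * s                          ≤⟨ ℤ.+-monoˡ-≤ (N * s) B≤φ ⟩
    φ (k - N * i) (l - N * j) + N * s  ≡⟨ shift ⟩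
    φ k l                              ≡⟨ lem (φ k l) B ⟩
    B + (φ k l - B)                    <⟨ ℤ.+-monoʳ-< B (ℤ.≤-<-trans (i≤+∣i∣ (φ k l - B)) (+<+ ℕ.≤-refl)) ⟩
    B + N                              ≡⟨ cong (λ z → B + z) (sym (ℤ.*-identityʳ N)) ⟩
    B + N * + 1                        ≤⟨ ℤ.+-monoʳ-≤ B (ℤ.*-monoˡ-≤-nonNeg N (sum-of-squares-pos ¬0)) ⟩
    B + N * s                          ∎)
    where
    open ℤ.≤-Reasoning
    lem : ∀ x B → x ≡ B + (x - B)
    lem = solve-∀

record Regular (d : LPoly) : Set where
  constructor regular
  field cancel-zero : ∀ {r} → d *ᴾ r ≋ 0ᴾ → r ≋ 0ᴾ
open Regular public

binomial : ℤ → ℤ → LPoly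
binomial i j = (+ 1 , 0ℤ , 0ℤ) ∷ (-[1+ 0 ] , i , j) ∷ []

binomial-regular : ∀ {i j} → ¬ (i ≡ 0ℤ × j ≡ 0ℤ) → Regular (binomial i j)
binomial-regular {i} {j} ¬0 = regular λ {r} br≋0 → coeffs (periodic⇒coeff≡0 ¬0 r (period r br≋0))
  where
  period : ∀ r → binomial i j *ᴾ r ≋ 0ᴾ → ∀ k l → coeff r k l ≡ coeff r (k - i) (l - j)
  period r br≋0 k l = cancel (coeff r k l) (coeff r (k - i) (l - j)) (begin
    coeff r k l + Y
      ≡⟨ cong₂ (λ u v → coeff r u v + Y) (sym (ℤ.+-identityʳ k)) (sym (ℤ.+-identityʳ l)) ⟩
    coeff r (k - 0ℤ) (l - 0ℤ) + Y
      ≡⟨ cong (_+ Y) (sym (ℤ.*-identityˡ (coeff r (k - 0ℤ) (l - 0ℤ)))) ⟩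
    + 1 * coeff r (k - 0ℤ) (l - 0ℤ) + Y
      ≡⟨ cong (λ z → + 1 * coeff r (k - 0ℤ) (l - 0ℤ) + z) (sym (coeff-*ᴾ-∷ˡ -[1+ 0 ] i j [] r k l)) ⟩
    + 1 * coeff r (k - 0ℤ) (l - 0ℤ) + coeff (((-[1+ 0 ] , i , j) ∷ []) *ᴾ r) k l
      ≡⟨ sym (coeff-*ᴾ-∷ˡ (+ 1) 0ℤ 0ℤ ((-[1+ 0 ] , i , j) ∷ []) r k l) ⟩
    coeff (binomial i j *ᴾ r) k l
      ≡⟨ coeff-≡ br≋0 k l ⟩
    0ℤ ∎)
    where
    open ≡-Reasoning
    Y = -[1+ 0 ] * coeff r (k - i) (l - j) + 0ℤ
    cancel : ∀ x y → x + (-[1+ 0 ] * y + 0ℤ) ≡ 0ℤ → x ≡ y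
    cancel x y eq = trans (lem x y) (trans (cong (_+ y) eq) (ℤ.+-identityˡ y))
      where lem : ∀ x y → x ≡ x + (-[1+ 0 ] * y + 0ℤ) + y
            lem = solve-∀

Regular-resp : ∀ {d d′} → d ≋ d′ → Regular d → Regular d′
Regular-resp d≋d′ reg = regular λ d′r≋0 → cancel-zero reg (≋-trans (*ᴾ-cong d≋d′ ≋-refl) d′r≋0)

1ᴾ-regular : Regular 1ᴾ
1ᴾ-regular = regular λ {r} 1r≋0 → ≋-trans (≋-sym (coeffs (coeff-*ᴾ-identityˡ r))) 1r≋0

*ᴾ-regular : ∀ {d e} → Regular d → Regular e → Regular (d *ᴾ e)
*ᴾ-regular {d} {e} reg-d reg-e = regular λ {r} der≋0 →
  cancel-zero reg-e (cancel-zero reg-d (≋-trans (≋-sym (coeffs (coeff-*ᴾ-assoc d e r))) der≋0))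

fac-regular : ∀ e → Regular (fac e)
fac-regular (i , j) = by-cases (i ≟ 0ℤ) (j ≟ 0ℤ)
  where
  by-cases : (i≟0 : Dec (i ≡ 0ℤ)) (j≟0 : Dec (j ≡ 0ℤ)) →
             Regular (if ⌊ i≟0 ⌋ ∧ ⌊ j≟0 ⌋ then 1ᴾ else binomial i j)
  by-cases (yes _)  (yes _)  = 1ᴾ-regular
  by-cases (yes _)  (no j≢0) = binomial-regular {i} {j} λ (_ , j≡0) → j≢0 j≡0
  by-cases (no i≢0) _        = binomial-regular {i} {j} λ (i≡0 , _) → i≢0 i≡0

facs : List Exp → LPoly
facs es = prodᴾ (map fac es)

facs-regular : ∀ es → Regular (facs es)
facs-regular []       = 1ᴾ-regular
facs-regular (e ∷ es) = *ᴾ-regular (fac-regular e) (facs-regular es)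

ExponentIs : ℤ → ℤ → Term → Set
ExponentIs k l (_ , i , j) = i ≡ k × j ≡ l

VanishesOnSupport : LPoly → Set
VanishesOnSupport p = AllExponents (λ i j → coeff p i j ≡ 0ℤ) p

vanishesOnSupport? : ∀ p → Dec (VanishesOnSupport p)
vanishesOnSupport? p = all? (λ { (_ , i , j) → coeff p i j ≟ 0ℤ }) p

vanishesOnSupport⇒≋0ᴾ : ∀ p → VanishesOnSupport p → p ≋ 0ᴾ
vanishesOnSupport⇒≋0ᴾ p vanishes = coeffs λ k l → by-cases k l (any? (exponentIs? k l) p)
  where
  exponentIs? : ∀ k l x → Dec (ExponentIs k l x)
  exponentIs? k l (_ , i , j) with i ≟ k | j ≟ l
  ... | yes i≡k | yes j≡l = yes (i≡k , j≡l)
  ... | no  i≢k | _       = no λ (i≡k , _) → i≢k i≡k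
  ... | yes _   | no  j≢l = no λ (_ , j≡l) → j≢l j≡l
  on-support : ∀ {k l q} → AllExponents (λ i j → coeff p i j ≡ 0ℤ) q → Any (ExponentIs k l) q → coeff p k l ≡ 0ℤ
  on-support (v All.∷ _)  (here (refl , refl)) = v
  on-support (_ All.∷ vs) (there hit)          = on-support vs hit
  by-cases : ∀ k l → Dec (Any (ExponentIs k l) p) → coeff p k l ≡ 0ℤ
  by-cases k l (yes hit)  = on-support vanishes hit
  by-cases k l (no  miss) =
    coeff-outside (λ i j → ¬ (i ≡ k × j ≡ l)) p (¬Any⇒All¬ p miss) λ ¬kl → ¬kl (refl , refl)

≋-from-difference : ∀ {p r} → p +ᴾ -ᴾ r ≋ 0ᴾ → p ≋ r
≋-from-difference {p} {r} p-r≋0 = begin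
  p                   ≈⟨ solve 2 (λ p r → p := (p :- r) :+ r) ≋-refl p r ⟩
  (p +ᴾ -ᴾ r) +ᴾ r    ≈⟨ +ᴾ-cong p-r≋0 ≋-refl ⟩
  r                   ∎
  where
  open ≋-Reasoning
  open LPoly-Solver using (solve; _:=_; _:+_; _:-_)

≋-by-computation : ∀ p r → {True (vanishesOnSupport? (p +ᴾ -ᴾ r))} → p ≋ r
≋-by-computation p r {vanishes} =
  ≋-from-difference (vanishesOnSupport⇒≋0ᴾ (p +ᴾ -ᴾ r) (toWitness vanishes))

-- Fractions with a regular denominator

recompute-≋ : ∀ {p r} → .(p ≋ r) → p ≋ r
recompute-≋ {p} {r} p≋r = coeffs λ k l → recompute (coeff p k l ≟ coeff r k l) (coeff-≡ p≋r k l)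

cancel-regular : ∀ {d p r} → .(Regular d) → d *ᴾ p ≋ d *ᴾ r → p ≋ r
cancel-regular {d} {p} {r} reg dp≋dr = recompute-≋ (≋-from-difference (cancel-zero reg (begin
  d *ᴾ (p +ᴾ -ᴾ r)           ≈⟨ solve 3 (λ d p r → d :* (p :- r) := d :* p :- d :* r) ≋-refl d p r ⟩
  (d *ᴾ p) +ᴾ -ᴾ (d *ᴾ r)    ≈⟨ +ᴾ-cong dp≋dr ≋-refl ⟩
  (d *ᴾ r) +ᴾ -ᴾ (d *ᴾ r)    ≈⟨ +ᴾ-inverseʳ (d *ᴾ r) ⟩
  0ᴾ                         ∎)))
  where
  open ≋-Reasoning
  open LPoly-Solver using (solve; _:=_; _:*_; _:-_)
  open CommutativeRing LPoly-commutativeRing using () renaming (-‿inverseʳ to +ᴾ-inverseʳ)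

infix 4 _≃_
_≃_ : RatFun → RatFun → Set
r ≃ s = num r *ᴾ den s ≋ num s *ᴾ den r

-ᴿ_ : RatFun → RatFun
-ᴿ r = (-ᴾ num r) / den r

≃-trans : ∀ r s t → .(Regular (den s)) → r ≃ s → s ≃ t → r ≃ t
≃-trans r s t reg ad≋cb cf≋ed = cancel-regular reg (begin
  d *ᴾ (a *ᴾ f)      ≈⟨ solve 3 (λ a d f → d :* (a :* f) := (a :* d) :* f) ≋-refl a d f ⟩
  (a *ᴾ d) *ᴾ f      ≈⟨ *ᴾ-cong ad≋cb ≋-refl ⟩
  (c *ᴾ b) *ᴾ f      ≈⟨ solve 3 (λ b c f → (c :* b) :* f := (c :* f) :* b) ≋-refl b c f ⟩
  (c *ᴾ f) *ᴾ b      ≈⟨ *ᴾ-cong cf≋ed ≋-refl ⟩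
  (e *ᴾ d) *ᴾ b      ≈⟨ solve 3 (λ b d e → (e :* d) :* b := d :* (e :* b)) ≋-refl b d e ⟩
  d *ᴾ (e *ᴾ b)      ∎)
  where
  open ≋-Reasoning
  open LPoly-Solver using (solve; _:=_; _:*_)
  a = num r; b = den r; c = num s; d = den s; e = num t; f = den t

+ᴿ-cong : ∀ r r′ s s′ → r ≃ r′ → s ≃ s′ → r +ᴿ s ≃ r′ +ᴿ s′
+ᴿ-cong r r′ s s′ ab′≋a′b cd′≋c′d = begin
  ((a *ᴾ d) +ᴾ (c *ᴾ b)) *ᴾ (b′ *ᴾ d′)
    ≈⟨ solve 6 (λ a b c d b′ d′ → (a :* d :+ c :* b) :* (b′ :* d′) := (a :* b′) :* (d :* d′) :+ (c :* d′) :* (b :* b′))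
               ≋-refl a b c d b′ d′ ⟩
  ((a *ᴾ b′) *ᴾ (d *ᴾ d′)) +ᴾ ((c *ᴾ d′) *ᴾ (b *ᴾ b′))
    ≈⟨ +ᴾ-cong (*ᴾ-cong ab′≋a′b ≋-refl) (*ᴾ-cong cd′≋c′d ≋-refl) ⟩
  ((a′ *ᴾ b) *ᴾ (d *ᴾ d′)) +ᴾ ((c′ *ᴾ d) *ᴾ (b *ᴾ b′))
    ≈⟨ solve 6 (λ a′ b c′ d b′ d′ → (a′ :* b) :* (d :* d′) :+ (c′ :* d) :* (b :* b′) := (a′ :* d′ :+ c′ :* b′) :* (b :* d))
               ≋-refl a′ b c′ d b′ d′ ⟩
  ((a′ *ᴾ d′) +ᴾ (c′ *ᴾ b′)) *ᴾ (b *ᴾ d) ∎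
  where
  open ≋-Reasoning
  open LPoly-Solver using (solve; _:=_; _:+_; _:*_)
  a = num r; b = den r; a′ = num r′; b′ = den r′; c = num s; d = den s; c′ = num s′; d′ = den s′

*ᴿ-cong : ∀ r r′ s s′ → r ≃ r′ → s ≃ s′ → r *ᴿ s ≃ r′ *ᴿ s′
*ᴿ-cong r r′ s s′ ab′≋a′b cd′≋c′d = begin
  (a *ᴾ c) *ᴾ (b′ *ᴾ d′)  ≈⟨ solve 4 (λ a c b′ d′ → (a :* c) :* (b′ :* d′) := (a :* b′) :* (c :* d′)) ≋-refl a c b′ d′ ⟩
  (a *ᴾ b′) *ᴾ (c *ᴾ d′)  ≈⟨ *ᴾ-cong ab′≋a′b cd′≋c′d ⟩
  (a′ *ᴾ b) *ᴾ (c′ *ᴾ d)  ≈⟨ solve 4 (λ a′ b c′ d → (a′ :* b) :* (c′ :* d) := (a′ :* c′) :* (b :* d)) ≋-refl a′ b c′ d ⟩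
  (a′ *ᴾ c′) *ᴾ (b *ᴾ d)  ∎
  where
  open ≋-Reasoning
  open LPoly-Solver using (solve; _:=_; _:*_)
  a = num r; b = den r; a′ = num r′; b′ = den r′; c = num s; d = den s; c′ = num s′; d′ = den s′

-ᴿ-cong : ∀ r r′ → r ≃ r′ → -ᴿ r ≃ -ᴿ r′
-ᴿ-cong r r′ ab′≋a′b = begin
  (-ᴾ a) *ᴾ b′  ≈⟨ solve 2 (λ a b′ → (:- a) :* b′ := :- (a :* b′)) ≋-refl a b′ ⟩
  -ᴾ (a *ᴾ b′)  ≈⟨ -ᴾ‿cong ab′≋a′b ⟩
  -ᴾ (a′ *ᴾ b)  ≈⟨ solve 2 (λ a′ b → :- (a′ :* b) := (:- a′) :* b) ≋-refl a′ b ⟩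
  (-ᴾ a′) *ᴾ b  ∎
  where
  open ≋-Reasoning
  open LPoly-Solver using (solve; _:=_; _:*_; :-_)
  a = num r; b = den r; a′ = num r′; b′ = den r′

-ᴿ-inverseˡ : ∀ r → (-ᴿ r) +ᴿ r ≃ 0ᴿ
-ᴿ-inverseˡ r = begin
  (((-ᴾ a) *ᴾ b) +ᴾ (a *ᴾ b)) *ᴾ 1ᴾ  ≈⟨ solve 2 (λ a b → ((:- a) :* b :+ a :* b) :* con (+ 1) := con (+ 0) :* (b :* b)) ≋-refl a b ⟩
  constᴾ (+ 0) *ᴾ (b *ᴾ b)           ≈⟨ *ᴾ-cong (_-Raw-AlmostCommutative⟶_.0-homo constᴾ-homomorphism) ≋-refl ⟩
  0ᴾ *ᴾ (b *ᴾ b)                     ∎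
  where
  open ≋-Reasoning
  open LPoly-Solver using (solve; _:=_; _:+_; _:*_; :-_; con)
  a = num r; b = den r

+ᴿ-assoc : ∀ r s t → (r +ᴿ s) +ᴿ t ≃ r +ᴿ (s +ᴿ t)
+ᴿ-assoc r s t = solve 6 (λ a b c d e f →
  ((a :* d :+ c :* b) :* f :+ e :* (b :* d)) :* (b :* (d :* f)) := (a :* (d :* f) :+ (c :* f :+ e :* d) :* b) :* ((b :* d) :* f))
  ≋-refl (num r) (den r) (num s) (den s) (num t) (den t)
  where open LPoly-Solver using (solve; _:=_; _:+_; _:*_)

+ᴿ-comm : ∀ r s → r +ᴿ s ≃ s +ᴿ r
+ᴿ-comm r s = solve 4 (λ a b c d → (a :* d :+ c :* b) :* (d :* b) := (c :* b :+ a :* d) :* (b :* d)) ≋-refl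
                (num r) (den r) (num s) (den s)
  where open LPoly-Solver using (solve; _:=_; _:+_; _:*_)

+ᴿ-identityˡ : ∀ r → 0ᴿ +ᴿ r ≃ r
+ᴿ-identityˡ r = solve 2 (λ a b → (a :* con (+ 1)) :* b := a :* (con (+ 1) :* b)) ≋-refl (num r) (den r)
  where open LPoly-Solver using (solve; _:=_; _:*_; con)

*ᴿ-assoc : ∀ r s t → (r *ᴿ s) *ᴿ t ≃ r *ᴿ (s *ᴿ t)
*ᴿ-assoc r s t = solve 6 (λ a b c d e f → ((a :* c) :* e) :* (b :* (d :* f)) := (a :* (c :* e)) :* ((b :* d) :* f))
  ≋-refl (num r) (den r) (num s) (den s) (num t) (den t)
  where open LPoly-Solver using (solve; _:=_; _:*_)

*ᴿ-comm : ∀ r s → r *ᴿ s ≃ s *ᴿ r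
*ᴿ-comm r s = solve 4 (λ a b c d → (a :* c) :* (d :* b) := (c :* a) :* (b :* d)) ≋-refl (num r) (den r) (num s) (den s)
  where open LPoly-Solver using (solve; _:=_; _:*_)

*ᴿ-identityˡ : ∀ r → poly 1ᴾ *ᴿ r ≃ r
*ᴿ-identityˡ r = solve 2 (λ a b → (con (+ 1) :* a) :* b := a :* (con (+ 1) :* b)) ≋-refl (num r) (den r)
  where open LPoly-Solver using (solve; _:=_; _:*_; con)

*ᴿ-distribʳ : ∀ r s t → (s +ᴿ t) *ᴿ r ≃ (s *ᴿ r) +ᴿ (t *ᴿ r)
*ᴿ-distribʳ r s t = solve 6 (λ a b c d e f →
  ((c :* f :+ e :* d) :* a) :* ((d :* b) :* (f :* b)) := ((c :* a) :* (f :* b) :+ (e :* a) :* (d :* b)) :* ((d :* f) :* b))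
  ≋-refl (num r) (den r) (num s) (den s) (num t) (den t)
  where open LPoly-Solver using (solve; _:=_; _:+_; _:*_)

poly-+ : ∀ p r → poly (p +ᴾ r) ≃ poly p +ᴿ poly r
poly-+ p r = solve 2 (λ p r → (p :+ r) :* (con (+ 1) :* con (+ 1)) := (p :* con (+ 1) :+ r :* con (+ 1)) :* con (+ 1)) ≋-refl p r
  where open LPoly-Solver using (solve; _:=_; _:+_; _:*_; con)

poly-* : ∀ p r → poly (p *ᴾ r) ≃ poly p *ᴿ poly r
poly-* p r = solve 2 (λ p r → (p :* r) :* (con (+ 1) :* con (+ 1)) := (p :* r) :* con (+ 1)) ≋-refl p r
  where open LPoly-Solver using (solve; _:=_; _:*_; con)

record Frac : Set where
  constructor frac
  field
    value        : RatFun
    .den-regular : Regular (den value)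
open Frac public

infix 4 _≈ᶠ_
record _≈ᶠ_ (x y : Frac) : Set where
  constructor fraction-≃
  field value-≃ : value x ≃ value y
open _≈ᶠ_ public

≈ᶠ-trans : ∀ {x y z} → x ≈ᶠ y → y ≈ᶠ z → x ≈ᶠ z
≈ᶠ-trans {x} {frac y reg} {z} (fraction-≃ x≃y) (fraction-≃ y≃z) = fraction-≃ (≃-trans (value x) y (value z) reg x≃y y≃z)

≈ᶠ-isEquivalence : IsEquivalence _≈ᶠ_
≈ᶠ-isEquivalence = record
  { refl  = fraction-≃ ≋-refl
  ; sym   = λ (fraction-≃ x≃y) → fraction-≃ (≋-sym x≃y)
  ; trans = ≈ᶠ-trans
  }

module ≈ᶠ = IsEquivalence ≈ᶠ-isEquivalence

infixl 6 _+ᶠ_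
infixl 7 _*ᶠ_
infix 8 -ᶠ_

-- Opaque, so that the type checker compares sums and products of fractions by their
-- summands and factors instead of multiplying out concrete weights.
opaque
  _+ᶠ_ : Frac → Frac → Frac
  frac r reg-r +ᶠ frac s reg-s = frac (r +ᴿ s) (*ᴾ-regular reg-r reg-s)

  _*ᶠ_ : Frac → Frac → Frac
  frac r reg-r *ᶠ frac s reg-s = frac (r *ᴿ s) (*ᴾ-regular reg-r reg-s)

  -ᶠ_ : Frac → Frac
  -ᶠ frac r reg-r = frac (-ᴿ r) reg-r

polyᶠ : LPoly → Frac
polyᶠ p = frac (poly p) 1ᴾ-regular

0ᶠ 1ᶠ : Frac
0ᶠ = polyᶠ 0ᴾ
1ᶠ = polyᶠ 1ᴾ

polyᶠ-cong : ∀ {p r} → p ≋ r → polyᶠ p ≈ᶠ polyᶠ r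
polyᶠ-cong p≋r = fraction-≃ (*ᴾ-cong p≋r ≋-refl)

opaque
  unfolding _+ᶠ_

  value-+ᶠ : ∀ x y → value (x +ᶠ y) ≡ value x +ᴿ value y
  value-+ᶠ x y = refl

  value-*ᶠ : ∀ x y → value (x *ᶠ y) ≡ value x *ᴿ value y
  value-*ᶠ x y = refl

  frac-+ᴿ : ∀ r s .{reg-r reg-s reg} → frac (r +ᴿ s) reg ≈ᶠ frac r reg-r +ᶠ frac s reg-s
  frac-+ᴿ r s = ≈ᶠ.refl

  +ᶠ-cong : ∀ {x x′ y y′} → x ≈ᶠ x′ → y ≈ᶠ y′ → x +ᶠ y ≈ᶠ x′ +ᶠ y′
  +ᶠ-cong {x} {x′} {y} {y′} (fraction-≃ p) (fraction-≃ q) = fraction-≃ (+ᴿ-cong (value x) (value x′) (value y) (value y′) p q)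

  *ᶠ-cong : ∀ {x x′ y y′} → x ≈ᶠ x′ → y ≈ᶠ y′ → x *ᶠ y ≈ᶠ x′ *ᶠ y′
  *ᶠ-cong {x} {x′} {y} {y′} (fraction-≃ p) (fraction-≃ q) = fraction-≃ (*ᴿ-cong (value x) (value x′) (value y) (value y′) p q)

  -ᶠ‿cong : ∀ {x x′} → x ≈ᶠ x′ → -ᶠ x ≈ᶠ -ᶠ x′
  -ᶠ‿cong {x} {x′} (fraction-≃ p) = fraction-≃ (-ᴿ-cong (value x) (value x′) p)

  +ᶠ-assoc : ∀ x y z → (x +ᶠ y) +ᶠ z ≈ᶠ x +ᶠ (y +ᶠ z)
  +ᶠ-assoc x y z = fraction-≃ (+ᴿ-assoc (value x) (value y) (value z))

  +ᶠ-comm : ∀ x y → x +ᶠ y ≈ᶠ y +ᶠ x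
  +ᶠ-comm x y = fraction-≃ (+ᴿ-comm (value x) (value y))

  +ᶠ-identityˡ : ∀ x → 0ᶠ +ᶠ x ≈ᶠ x
  +ᶠ-identityˡ x = fraction-≃ (+ᴿ-identityˡ (value x))

  -ᶠ‿inverseˡ : ∀ x → (-ᶠ x) +ᶠ x ≈ᶠ 0ᶠ
  -ᶠ‿inverseˡ x = fraction-≃ (-ᴿ-inverseˡ (value x))

  *ᶠ-assoc : ∀ x y z → (x *ᶠ y) *ᶠ z ≈ᶠ x *ᶠ (y *ᶠ z)
  *ᶠ-assoc x y z = fraction-≃ (*ᴿ-assoc (value x) (value y) (value z))

  *ᶠ-comm : ∀ x y → x *ᶠ y ≈ᶠ y *ᶠ x
  *ᶠ-comm x y = fraction-≃ (*ᴿ-comm (value x) (value y))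

  *ᶠ-identityˡ : ∀ x → 1ᶠ *ᶠ x ≈ᶠ x
  *ᶠ-identityˡ x = fraction-≃ (*ᴿ-identityˡ (value x))

  *ᶠ-distribʳ : ∀ x y z → (y +ᶠ z) *ᶠ x ≈ᶠ (y *ᶠ x) +ᶠ (z *ᶠ x)
  *ᶠ-distribʳ x y z = fraction-≃ (*ᴿ-distribʳ (value x) (value y) (value z))

  polyᶠ-+ : ∀ p r → polyᶠ (p +ᴾ r) ≈ᶠ polyᶠ p +ᶠ polyᶠ r
  polyᶠ-+ p r = fraction-≃ (poly-+ p r)

  polyᶠ-* : ∀ p r → polyᶠ (p *ᴾ r) ≈ᶠ polyᶠ p *ᶠ polyᶠ r
  polyᶠ-* p r = fraction-≃ (poly-* p r)

  polyᶠ--ᴾ : ∀ p → polyᶠ (-ᴾ p) ≈ᶠ -ᶠ polyᶠ p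
  polyᶠ--ᴾ p = ≈ᶠ.refl

Frac-isCommutativeRing : IsCommutativeRing _≈ᶠ_ _+ᶠ_ _*ᶠ_ -ᶠ_ 0ᶠ 1ᶠ
Frac-isCommutativeRing = record
  { isRing = record
    { +-isAbelianGroup = record
      { isGroup = record
        { isMonoid = record
          { isSemigroup = record
            { isMagma = record { isEquivalence = ≈ᶠ-isEquivalence ; ∙-cong = +ᶠ-cong }
            ; assoc   = +ᶠ-assoc }
          ; identity = +ᶠ-identityˡ , λ x → ≈ᶠ.trans (+ᶠ-comm x 0ᶠ) (+ᶠ-identityˡ x) }
        ; inverse = -ᶠ‿inverseˡ , λ x → ≈ᶠ.trans (+ᶠ-comm x (-ᶠ x)) (-ᶠ‿inverseˡ x)
        ; ⁻¹-cong = -ᶠ‿cong }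
      ; comm = +ᶠ-comm }
    ; *-cong     = *ᶠ-cong
    ; *-assoc    = *ᶠ-assoc
    ; *-identity = *ᶠ-identityˡ , λ x → ≈ᶠ.trans (*ᶠ-comm x 1ᶠ) (*ᶠ-identityˡ x)
    ; distrib    = (λ x y z → ≈ᶠ.trans (*ᶠ-comm x (y +ᶠ z))
                      (≈ᶠ.trans (*ᶠ-distribʳ x y z) (+ᶠ-cong (*ᶠ-comm y x) (*ᶠ-comm z x))))
                 , *ᶠ-distribʳ }
  ; *-comm = *ᶠ-comm
  }

Frac-commutativeRing : CommutativeRing 0ℓ 0ℓ
Frac-commutativeRing = record { isCommutativeRing = Frac-isCommutativeRing }

open CommutativeRing Frac-commutativeRing
  using (zeroˡ; -‿inverseʳ; *-identityʳ) renaming (setoid to Frac-setoid; +-identityʳ to +ᶠ-identityʳ)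

module ≈ᶠ-Reasoning = SetoidReasoning Frac-setoid

constᶠ-homomorphism : ℤ.+-*-rawRing -Raw-AlmostCommutative⟶ fromCommutativeRing Frac-commutativeRing
constᶠ-homomorphism = record
  { ⟦_⟧    = λ a → polyᶠ (constᴾ a)
  ; +-homo = λ a b → ≈ᶠ.trans (polyᶠ-cong (+-homo a b)) (polyᶠ-+ (constᴾ a) (constᴾ b))
  ; *-homo = λ a b → ≈ᶠ.trans (polyᶠ-cong (*-homo a b)) (polyᶠ-* (constᴾ a) (constᴾ b))
  ; -‿homo = λ a → ≈ᶠ.trans (polyᶠ-cong (-‿homo a)) (polyᶠ--ᴾ (constᴾ a))
  ; 0-homo = polyᶠ-cong 0-homo
  ; 1-homo = ≈ᶠ.refl
  }
  where open _-Raw-AlmostCommutative⟶_ constᴾ-homomorphism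

constᶠ-≟ : ∀ a b → Maybe (polyᶠ (constᴾ a) ≈ᶠ polyᶠ (constᴾ b))
constᶠ-≟ a b with a ≟ b
... | yes refl = just ≈ᶠ.refl
... | no  _    = nothing

module Frac-Solver = Algebra.Solver.Ring ℤ.+-*-rawRing (fromCommutativeRing Frac-commutativeRing)
                       constᶠ-homomorphism constᶠ-≟

≈ᶠ-by-computation : ∀ x y →
  {True (vanishesOnSupport? ((num (value x) *ᴾ den (value y)) +ᴾ -ᴾ (num (value y) *ᴾ den (value x))))} → x ≈ᶠ y
≈ᶠ-by-computation x y {vanishes} = fraction-≃ (≋-by-computation _ _ {vanishes})

-- The weights of tableaux as products of factors 1 - q^i t^j

facs-++ : ∀ es fs → facs (es ++ fs) ≋ facs es *ᴾ facs fs
facs-++ []       fs = ≋-sym (coeffs (coeff-*ᴾ-identityˡ (facs fs)))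
facs-++ (e ∷ es) fs = begin
  fac e *ᴾ facs (es ++ fs)       ≈⟨ *ᴾ-congˡ (fac e) (facs-++ es fs) ⟩
  fac e *ᴾ (facs es *ᴾ facs fs)  ≈⟨ ≋-sym (coeffs (coeff-*ᴾ-assoc (fac e) (facs es) (facs fs))) ⟩
  (fac e *ᴾ facs es) *ᴾ facs fs  ∎
  where open ≋-Reasoning

prodᴾ-fac-pairs : {A : Set} (f : A → LPoly) (e₁ e₂ : A → Exp) → (∀ x → f x ≡ fac (e₁ x) *ᴾ fac (e₂ x)) →
                  ∀ xs → prodᴾ (map f xs) ≋ facs (concatMap (λ x → e₁ x ∷ e₂ x ∷ []) xs)
prodᴾ-fac-pairs f e₁ e₂ f≡ []       = ≋-refl
prodᴾ-fac-pairs f e₁ e₂ f≡ (x ∷ xs) rewrite f≡ x = begin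
  (fac (e₁ x) *ᴾ fac (e₂ x)) *ᴾ prodᴾ (map f xs)
    ≈⟨ coeffs (coeff-*ᴾ-assoc (fac (e₁ x)) (fac (e₂ x)) _) ⟩
  fac (e₁ x) *ᴾ (fac (e₂ x) *ᴾ prodᴾ (map f xs))
    ≈⟨ *ᴾ-congˡ (fac (e₁ x)) (*ᴾ-congˡ (fac (e₂ x)) (prodᴾ-fac-pairs f e₁ e₂ f≡ xs)) ⟩
  fac (e₁ x) *ᴾ (fac (e₂ x) *ᴾ facs (concatMap (λ x → e₁ x ∷ e₂ x ∷ []) xs)) ∎
  where open ≋-Reasoning

ratio q-ratio t-ratio qt-ratio inverse : Exp × Exp → Exp
ratio    ((u₁ , u₂) , (v₁ , v₂)) = (u₁ - v₁ , u₂ - v₂)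
q-ratio  ((u₁ , u₂) , (v₁ , v₂)) = (+ 1 + u₁ - v₁ , u₂ - v₂)
t-ratio  ((u₁ , u₂) , (v₁ , v₂)) = (u₁ - v₁ , + 1 + u₂ - v₂)
qt-ratio ((u₁ , u₂) , (v₁ , v₂)) = (+ 1 + u₁ - v₁ , + 1 + u₂ - v₂)
inverse  ((u₁ , u₂) , (v₁ , v₂)) = (- v₁ , - v₂)

numExps denExps : List Cell → List Exp
numExps T = concatMap (λ x → ratio x ∷ qt-ratio x ∷ []) (pairsLt (map zExp T))
denExps T = concatMap (λ x → inverse x ∷ qt-ratio x ∷ []) (zip (map zExp T) (drop 1 (map zExp T)))
         ++ concatMap (λ x → q-ratio x ∷ t-ratio x ∷ []) (pairsLt (map zExp T))

wt-num : ∀ T → num (wt T) ≋ facs (numExps T)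
wt-num T = prodᴾ-fac-pairs _ ratio qt-ratio (λ _ → refl) (pairsLt (map zExp T))

wt-den : ∀ T → den (wt T) ≋ facs (denExps T)
wt-den T = begin
  den (wt T)
    ≈⟨ *ᴾ-cong (prodᴾ-fac-pairs _ inverse qt-ratio (λ _ → refl) consecutive)
               (prodᴾ-fac-pairs _ q-ratio t-ratio (λ _ → refl) (pairsLt zs)) ⟩
  facs (concatMap (λ x → inverse x ∷ qt-ratio x ∷ []) consecutive)
    *ᴾ facs (concatMap (λ x → q-ratio x ∷ t-ratio x ∷ []) (pairsLt zs))
    ≈⟨ ≋-sym (facs-++ (concatMap (λ x → inverse x ∷ qt-ratio x ∷ []) consecutive) _) ⟩
  facs (denExps T) ∎
  where
  open ≋-Reasoning
  zs = map zExp T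
  consecutive = zip zs (drop 1 zs)

wt-regular : ∀ T → Regular (den (wt T))
wt-regular T = Regular-resp (≋-sym (wt-den T)) (facs-regular (denExps T))

_≟ₑ_ : (e f : Exp) → Dec (e ≡ f)
_≟ₑ_ = ≡-dec _≟_ _≟_

facs-↭ : ∀ {es fs} → es ↭ fs → facs es ≋ facs fs
facs-↭ ↭.refl        = ≋-refl
facs-↭ (prep e p)    = *ᴾ-congˡ (fac e) (facs-↭ p)
facs-↭ (swap {xs = es} {ys = fs} e f p) = begin
  fac e *ᴾ (fac f *ᴾ facs es)  ≈⟨ *ᴾ-congˡ (fac e) (*ᴾ-congˡ (fac f) (facs-↭ p)) ⟩
  fac e *ᴾ (fac f *ᴾ facs fs)  ≈⟨ solve 3 (λ x y z → x :* (y :* z) := y :* (x :* z)) ≋-refl (fac e) (fac f) (facs fs) ⟩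
  fac f *ᴾ (fac e *ᴾ facs fs)  ∎
  where
  open ≋-Reasoning
  open LPoly-Solver using (solve; _:=_; _:*_)
facs-↭ (↭.trans p q) = ≋-trans (facs-↭ p) (facs-↭ q)

select : ∀ e fs → Maybe (∃[ gs ] fs ↭ e ∷ gs)
select e []       = nothing
select e (f ∷ fs) with e ≟ₑ f
... | yes refl = just (fs , ↭.refl)
... | no  _    = Maybe.map (λ (gs , p) → f ∷ gs , ↭.trans (prep f p) (swap f e ↭.refl)) (select e fs)

permutation? : ∀ es fs → Maybe (es ↭ fs)
permutation? []       []      = just ↭.refl
permutation? []       (_ ∷ _) = nothing
permutation? (e ∷ es) fs with select e fs
... | nothing       = nothing
... | just (gs , p) = Maybe.map (λ q → ↭.trans (prep e q) (↭-sym p)) (permutation? es gs)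

-- fac (0 , 0) is 1: wt omits its vanishing factors.
dropTrivial : List Exp → List Exp
dropTrivial []       = []
dropTrivial (e ∷ es) with e ≟ₑ (0ℤ , 0ℤ)
... | yes _ = dropTrivial es
... | no  _ = e ∷ dropTrivial es

facs-dropTrivial : ∀ es → facs (dropTrivial es) ≋ facs es
facs-dropTrivial []       = ≋-refl
facs-dropTrivial (e ∷ es) with e ≟ₑ (0ℤ , 0ℤ)
... | yes refl = ≋-trans (facs-dropTrivial es) (≋-sym (coeffs (coeff-*ᴾ-identityˡ (facs es))))
... | no  _    = *ᴾ-congˡ (fac e) (facs-dropTrivial es)

SameFactors : List Exp → List Exp → Set
SameFactors es fs = IsTrue (is-just (permutation? (dropTrivial es) (dropTrivial fs)))

t/q : Exp
t/q = (-[1+ 0 ] , + 1)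

weight-≃ : ∀ T α β → dropTrivial (t/q ∷ numExps T ++ β) ↭ dropTrivial (α ++ denExps T) →
           poly oneMinusTOverQ *ᴿ wt T ≃ facs α / facs β
weight-≃ T α β same = begin
  (oneMinusTOverQ *ᴾ num (wt T)) *ᴾ facs β      ≈⟨ *ᴾ-cong (*ᴾ-congˡ (fac t/q) (wt-num T)) ≋-refl ⟩
  (fac t/q *ᴾ facs (numExps T)) *ᴾ facs β       ≈⟨ coeffs (coeff-*ᴾ-assoc (fac t/q) (facs (numExps T)) (facs β)) ⟩
  fac t/q *ᴾ (facs (numExps T) *ᴾ facs β)       ≈⟨ *ᴾ-congˡ (fac t/q) (≋-sym (facs-++ (numExps T) β)) ⟩
  facs (t/q ∷ numExps T ++ β)                   ≈⟨ ≋-sym (facs-dropTrivial (t/q ∷ numExps T ++ β)) ⟩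
  facs (dropTrivial (t/q ∷ numExps T ++ β))     ≈⟨ facs-↭ same ⟩
  facs (dropTrivial (α ++ denExps T))           ≈⟨ facs-dropTrivial (α ++ denExps T) ⟩
  facs (α ++ denExps T)                         ≈⟨ facs-++ α (denExps T) ⟩
  facs α *ᴾ facs (denExps T)                    ≈⟨ *ᴾ-congˡ (facs α) (≋-trans (≋-sym (wt-den T))
                                                     (≋-sym (coeffs (coeff-*ᴾ-identityˡ (den (wt T)))))) ⟩
  facs α *ᴾ (1ᴾ *ᴾ den (wt T))                  ∎
  where open ≋-Reasoning

infix 9 _÷_
_÷_ : LPoly → List Exp → Frac
n ÷ es = frac (n / facs es) (facs-regular es)

infix 10 q^_t^_
q^_t^_ : ℤ → ℤ → Frac
q^ i t^ j = polyᶠ (mono i j)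

H-term : List ℤ → List Cell → RatFun
H-term as T = poly (zPow as (drop 1 T)) *ᴿ poly oneMinusTOverQ *ᴿ wt T

H-term-regular : ∀ as T → Regular (den (H-term as T))
H-term-regular as T = *ᴾ-regular (*ᴾ-regular 1ᴾ-regular 1ᴾ-regular) (wt-regular T)

H-tableaux : ℕ → List (List Cell)
H-tableaux n = filterᵇ twoAtq (SYT (suc n))

sumᴿ-regular : {A : Set} (f : A → RatFun) → (∀ x → Regular (den (f x))) → ∀ xs → Regular (den (sumᴿ (map f xs)))
sumᴿ-regular f reg []       = 1ᴾ-regular
sumᴿ-regular f reg (x ∷ xs) = *ᴾ-regular (reg x) (sumᴿ-regular f reg xs)

-- Opaque, so that H and wt are never unfolded at concrete arguments.
opaque
  wtᶠ : List Cell → Frac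
  wtᶠ T = frac (wt T) (wt-regular T)

  Hᶠ : List ℤ → Frac
  Hᶠ as = frac (H as) (sumᴿ-regular (H-term as) (H-term-regular as) (H-tableaux (length as)))

H-termᶠ : List ℤ → List Cell → Frac
H-termᶠ as T = polyᶠ (zPow as (drop 1 T)) *ᶠ polyᶠ oneMinusTOverQ *ᶠ wtᶠ T

sumᶠ : List Frac → Frac
sumᶠ = foldr _+ᶠ_ 0ᶠ

≡⇒≈ᶠ : ∀ {r} .{reg} {y} → r ≡ value y → frac r reg ≈ᶠ y
≡⇒≈ᶠ refl = fraction-≃ ≋-refl

sumᴿ≈sumᶠ : {A : Set} (f : A → RatFun) (g : A → Frac) → (∀ x → f x ≡ value (g x)) →
            .(reg : ∀ x → Regular (den (f x))) → ∀ xs → frac (sumᴿ (map f xs)) (sumᴿ-regular f reg xs) ≈ᶠ sumᶠ (map g xs)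
sumᴿ≈sumᶠ f g f≡g reg []       = ≈ᶠ.refl
sumᴿ≈sumᶠ f g f≡g reg (x ∷ xs) =
  ≈ᶠ.trans (frac-+ᴿ (f x) (sumᴿ (map f xs)) {reg x} {sumᴿ-regular f reg xs})
           (+ᶠ-cong (≡⇒≈ᶠ (f≡g x)) (sumᴿ≈sumᶠ f g f≡g reg xs))

opaque
  unfolding Hᶠ _+ᶠ_

  Hᶠ-value : ∀ as → value (Hᶠ as) ≡ H as
  Hᶠ-value as = refl

  H≈sum : ∀ as → Hᶠ as ≈ᶠ sumᶠ (map (H-termᶠ as) (H-tableaux (length as)))
  H≈sum as = sumᴿ≈sumᶠ (H-term as) (H-termᶠ as) (λ _ → refl) (H-term-regular as) (H-tableaux (length as))

  weight-≈ : ∀ T α β → dropTrivial (t/q ∷ numExps T ++ β) ↭ dropTrivial (α ++ denExps T) →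
             polyᶠ oneMinusTOverQ *ᶠ wtᶠ T ≈ᶠ facs α ÷ β
  weight-≈ T α β same = fraction-≃ (weight-≃ T α β same)

H-termᶠ-≈ : ∀ as T i j α β → zPow as (drop 1 T) ≡ mono i j →
            {SameFactors (t/q ∷ numExps T ++ β) (α ++ denExps T)} →
            H-termᶠ as T ≈ᶠ q^ i t^ j *ᶠ (facs α ÷ β)
H-termᶠ-≈ as T i j α β z≡ {same} = begin
  polyᶠ z *ᶠ polyᶠ oneMinusTOverQ *ᶠ wtᶠ T    ≈⟨ *ᶠ-assoc (polyᶠ z) (polyᶠ oneMinusTOverQ) (wtᶠ T) ⟩
  polyᶠ z *ᶠ (polyᶠ oneMinusTOverQ *ᶠ wtᶠ T)  ≈⟨ *ᶠ-cong (polyᶠ-cong (≋-reflexive z≡)) (weight-≈ T α β factors) ⟩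
  q^ i t^ j *ᶠ (facs α ÷ β)                   ∎
  where
  open ≈ᶠ-Reasoning
  z = zPow as (drop 1 T)
  factors = to-witness-T (permutation? (dropTrivial (t/q ∷ numExps T ++ β)) (dropTrivial (α ++ denExps T))) same

-- H with two, three and four boxes

w₁ w₂ w₃ w₄ w₅ u₁ u₂ v : Frac
w₁ = 1ᴾ ÷ ((- + 3 , + 1) ∷ (- + 2 , + 1) ∷ [])
w₂ = 1ᴾ ÷ ((- + 2 , + 1) ∷ (+ 3 , - + 1) ∷ [])
w₃ = facs ((0ℤ , + 1) ∷ []) ÷ ((- + 2 , + 2) ∷ (- + 1 , + 1) ∷ (+ 2 , - + 1) ∷ [])
w₄ = facs ((+ 1 , 0ℤ) ∷ []) ÷ ((- + 1 , + 1) ∷ (+ 1 , - + 1) ∷ (+ 2 , - + 1) ∷ [])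
w₅ = 1ᴾ ÷ ((+ 1 , - + 1) ∷ (+ 2 , - + 2) ∷ [])
u₁ = 1ᴾ ÷ ((- + 2 , + 1) ∷ [])
u₂ = 1ᴾ ÷ ((+ 2 , - + 1) ∷ [])
v  = 1ᴾ ÷ ((+ 2 , - + 2) ∷ [])

H₂-expansion : ∀ a → Hᶠ (a ∷ []) ≈ᶠ q^ a t^ 0ℤ *ᶠ 1ᶠ
H₂-expansion a = ≈ᶠ.trans (H≈sum (a ∷ [])) (≈ᶠ.trans (+ᶠ-identityʳ (H-termᶠ (a ∷ []) T))
  (H-termᶠ-≈ (a ∷ []) T a 0ℤ [] [] (cong₂ mono (ℤ-Solver.solve (a ∷ [])) (ℤ-Solver.solve (a ∷ [])))))
  where T = (0 , 0) ∷ (0 , 1) ∷ []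

H₃-expansion : ∀ a b → Hᶠ (a ∷ b ∷ []) ≈ᶠ q^ (a + + 2 * b) t^ 0ℤ *ᶠ u₁ +ᶠ q^ a t^ b *ᶠ u₂
H₃-expansion a b = ≈ᶠ.trans (H≈sum as)
  (+ᶠ-cong (H-termᶠ-≈ as ((0 , 0) ∷ (0 , 1) ∷ (0 , 2) ∷ []) (a + + 2 * b) 0ℤ [] ((- + 2 , + 1) ∷ [])
             (cong₂ mono (ℤ-Solver.solve (a ∷ b ∷ [])) (ℤ-Solver.solve (a ∷ b ∷ []))))
  (≈ᶠ.trans (+ᶠ-identityʳ (H-termᶠ as ((0 , 0) ∷ (0 , 1) ∷ (1 , 0) ∷ [])))
           (H-termᶠ-≈ as ((0 , 0) ∷ (0 , 1) ∷ (1 , 0) ∷ []) a b [] ((+ 2 , - + 1) ∷ [])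
             (cong₂ mono (ℤ-Solver.solve (a ∷ b ∷ [])) (ℤ-Solver.solve (a ∷ b ∷ []))))))
  where as = a ∷ b ∷ []

H₄-expansion : ∀ a b c → Hᶠ (a ∷ b ∷ c ∷ []) ≈ᶠ
     q^ (a + + 2 * b + + 3 * c) t^ 0ℤ *ᶠ w₁
  +ᶠ (q^ (a + + 2 * b) t^ c *ᶠ w₂
  +ᶠ (q^ (a + + 2 * c) t^ b *ᶠ w₃
  +ᶠ (q^ (a + c) t^ (b + c) *ᶠ w₄
  +ᶠ  q^ a t^ (b + + 2 * c) *ᶠ w₅)))
H₄-expansion a b c = ≈ᶠ.trans (H≈sum as)
  (+ᶠ-cong (H-termᶠ-≈ as ((0 , 0) ∷ (0 , 1) ∷ (0 , 2) ∷ (0 , 3) ∷ []) (a + + 2 * b + + 3 * c) 0ℤ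
             [] ((- + 3 , + 1) ∷ (- + 2 , + 1) ∷ [])
             (cong₂ mono (ℤ-Solver.solve (a ∷ b ∷ c ∷ [])) (ℤ-Solver.solve (a ∷ b ∷ c ∷ []))))
  (+ᶠ-cong (H-termᶠ-≈ as ((0 , 0) ∷ (0 , 1) ∷ (0 , 2) ∷ (1 , 0) ∷ []) (a + + 2 * b) c
             [] ((- + 2 , + 1) ∷ (+ 3 , - + 1) ∷ [])
             (cong₂ mono (ℤ-Solver.solve (a ∷ b ∷ c ∷ [])) (ℤ-Solver.solve (a ∷ b ∷ c ∷ []))))
  (+ᶠ-cong (H-termᶠ-≈ as ((0 , 0) ∷ (0 , 1) ∷ (1 , 0) ∷ (0 , 2) ∷ []) (a + + 2 * c) b
             ((0ℤ , + 1) ∷ []) ((- + 2 , + 2) ∷ (- + 1 , + 1) ∷ (+ 2 , - + 1) ∷ [])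
             (cong₂ mono (ℤ-Solver.solve (a ∷ b ∷ c ∷ [])) (ℤ-Solver.solve (a ∷ b ∷ c ∷ []))))
  (+ᶠ-cong (H-termᶠ-≈ as ((0 , 0) ∷ (0 , 1) ∷ (1 , 0) ∷ (1 , 1) ∷ []) (a + c) (b + c)
             ((+ 1 , 0ℤ) ∷ []) ((- + 1 , + 1) ∷ (+ 1 , - + 1) ∷ (+ 2 , - + 1) ∷ [])
             (cong₂ mono (ℤ-Solver.solve (a ∷ b ∷ c ∷ [])) (ℤ-Solver.solve (a ∷ b ∷ c ∷ []))))
  (≈ᶠ.trans (+ᶠ-identityʳ (H-termᶠ as ((0 , 0) ∷ (0 , 1) ∷ (1 , 0) ∷ (2 , 0) ∷ [])))
            (H-termᶠ-≈ as ((0 , 0) ∷ (0 , 1) ∷ (1 , 0) ∷ (2 , 0) ∷ []) a (b + + 2 * c)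
             [] ((+ 1 , - + 1) ∷ (+ 2 , - + 2) ∷ [])
             (cong₂ mono (ℤ-Solver.solve (a ∷ b ∷ c ∷ [])) (ℤ-Solver.solve (a ∷ b ∷ c ∷ [])))))))))
  where as = a ∷ b ∷ c ∷ []

-- The recursion

opaque
  unfolding _+ᶠ_

  w₂-split : w₂ ≈ᶠ q^ (+ 3) t^ (- + 1) *ᶠ w₂ +ᶠ u₁
  w₂-split = ≈ᶠ-by-computation _ _

  w₃-split : w₃ ≈ᶠ q^ (- + 1) t^ (+ 1) *ᶠ w₃ +ᶠ u₂ +ᶠ -ᶠ v
  w₃-split = ≈ᶠ-by-computation _ _

  w₅-split : w₅ ≈ᶠ q^ (+ 1) t^ (- + 1) *ᶠ w₅ +ᶠ v
  w₅-split = ≈ᶠ-by-computation _ _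

  v-inverse : (1ᶠ +ᶠ -ᶠ q^ (+ 2) t^ (- + 2)) *ᶠ v ≈ᶠ 1ᶠ
  v-inverse = ≈ᶠ-by-computation _ _

regroup : ∀ z₁ z₂ z₃ z₄ z₅ w₁ w₂ w₃ w₄ w₅ M K N u₁ u₂ v →
  z₁ *ᶠ w₁ +ᶠ (z₂ *ᶠ (M *ᶠ w₂ +ᶠ u₁) +ᶠ (z₃ *ᶠ (K *ᶠ w₃ +ᶠ u₂ +ᶠ -ᶠ v) +ᶠ (z₄ *ᶠ w₄ +ᶠ z₅ *ᶠ (N *ᶠ w₅ +ᶠ v))))
  ≈ᶠ (z₁ *ᶠ w₁ +ᶠ ((z₂ *ᶠ M) *ᶠ w₂ +ᶠ ((z₃ *ᶠ K) *ᶠ w₃ +ᶠ (z₄ *ᶠ w₄ +ᶠ (z₅ *ᶠ N) *ᶠ w₅))))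
     +ᶠ (z₂ *ᶠ u₁ +ᶠ z₃ *ᶠ u₂) +ᶠ (z₅ +ᶠ -ᶠ z₃) *ᶠ v
regroup = solve 16 (λ z₁ z₂ z₃ z₄ z₅ w₁ w₂ w₃ w₄ w₅ M K N u₁ u₂ v →
  z₁ :* w₁ :+ (z₂ :* (M :* w₂ :+ u₁) :+ (z₃ :* (K :* w₃ :+ u₂ :+ :- v) :+ (z₄ :* w₄ :+ z₅ :* (N :* w₅ :+ v))))
  := (z₁ :* w₁ :+ ((z₂ :* M) :* w₂ :+ ((z₃ :* K) :* w₃ :+ (z₄ :* w₄ :+ (z₅ :* N) :* w₅))))
     :+ (z₂ :* u₁ :+ z₃ :* u₂) :+ (z₅ :+ :- z₃) :* v) ≈ᶠ.refl
  where open Frac-Solver using (solve; _:=_; _:+_; _:*_; :-_)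

q^t^-cong : ∀ {i i′ j j′} → i ≡ i′ → j ≡ j′ → q^ i t^ j ≈ᶠ q^ i′ t^ j′
q^t^-cong refl refl = ≈ᶠ.refl

q^t^-* : ∀ i j k l → q^ i t^ j *ᶠ q^ k t^ l ≈ᶠ q^ (i + k) t^ (j + l)
q^t^-* i j k l = ≈ᶠ.sym (polyᶠ-* (mono i j) (mono k l))

Σᶠ : ℕ → (ℕ → Frac) → Frac
Σᶠ zero    f = 0ᶠ
Σᶠ (suc n) f = Σᶠ n f +ᶠ f n

Σᶠ-cong : ∀ {f g} → (∀ i → f i ≈ᶠ g i) → ∀ n → Σᶠ n f ≈ᶠ Σᶠ n g
Σᶠ-cong f≈g zero    = ≈ᶠ.refl
Σᶠ-cong f≈g (suc n) = +ᶠ-cong (Σᶠ-cong f≈g n) (f≈g n)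

geometric : ∀ n A B → Σᶠ n (λ i → q^ (A + + 2 * + i) t^ (B + + 2 * + n - + 2 * + i)) *ᶠ (1ᶠ +ᶠ -ᶠ q^ (+ 2) t^ (- + 2))
                      ≈ᶠ q^ A t^ (B + + 2 * + n) +ᶠ -ᶠ q^ (A + + 2 * + n) t^ B
geometric zero A B = begin
  0ᶠ *ᶠ (1ᶠ +ᶠ -ᶠ q^ (+ 2) t^ (- + 2))  ≈⟨ zeroˡ (1ᶠ +ᶠ -ᶠ q^ (+ 2) t^ (- + 2)) ⟩
  0ᶠ                                    ≈⟨ ≈ᶠ.sym (-‿inverseʳ (q^ A t^ B)) ⟩
  q^ A t^ B +ᶠ -ᶠ q^ A t^ B              ≈⟨ +ᶠ-cong (q^t^-cong refl (sym (ℤ.+-identityʳ B)))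
                                                     (-ᶠ‿cong (q^t^-cong (sym (ℤ.+-identityʳ A)) refl)) ⟩
  q^ A t^ (B + + 2 * + 0) +ᶠ -ᶠ q^ (A + + 2 * + 0) t^ B ∎
  where open ≈ᶠ-Reasoning
geometric (suc n) A B = begin
  (Σᶠ n f +ᶠ f n) *ᶠ D
    ≈⟨ *ᶠ-cong (+ᶠ-cong (Σᶠ-cong (λ i → q^t^-cong refl (shift B (+ n) (+ i))) n) (q^t^-cong refl (last B (+ n))))
               (≈ᶠ.refl {D}) ⟩
  (Σᶠ n g +ᶠ Q) *ᶠ D
    ≈⟨ *ᶠ-distribʳ D (Σᶠ n g) Q ⟩
  Σᶠ n g *ᶠ D +ᶠ Q *ᶠ D
    ≈⟨ +ᶠ-cong (geometric n A (B + + 2)) (solve 2 (λ Q X → Q :* (con (+ 1) :+ :- X) := Q :+ :- (Q :* X)) ≈ᶠ.refl Q X) ⟩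
  (P +ᶠ -ᶠ Q) +ᶠ (Q +ᶠ -ᶠ (Q *ᶠ X))
    ≈⟨ solve 3 (λ P Q R → (P :+ :- Q) :+ (Q :+ :- R) := P :+ :- R) ≈ᶠ.refl P Q (Q *ᶠ X) ⟩
  P +ᶠ -ᶠ (Q *ᶠ X)
    ≈⟨ +ᶠ-cong (q^t^-cong refl (first B (+ n)))
               (-ᶠ‿cong (≈ᶠ.trans (q^t^-* (A + + 2 * + n) (B + + 2) (+ 2) (- + 2)) (q^t^-cong (step A (+ n)) (back B)))) ⟩
  q^ A t^ (B + + 2 * + suc n) +ᶠ -ᶠ q^ (A + + 2 * + suc n) t^ B ∎
  where
  open ≈ᶠ-Reasoning
  open Frac-Solver using (solve; _:=_; _:+_; _:*_; :-_; con)
  X = q^ (+ 2) t^ (- + 2)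
  D = 1ᶠ +ᶠ -ᶠ X
  f g : ℕ → Frac
  f i = q^ (A + + 2 * + i) t^ (B + + 2 * + suc n - + 2 * + i)
  g i = q^ (A + + 2 * + i) t^ (B + + 2 + + 2 * + n - + 2 * + i)
  P = q^ A t^ (B + + 2 + + 2 * + n)
  Q = q^ (A + + 2 * + n) t^ (B + + 2)
  shift : ∀ B N I → B + + 2 * (+ 1 + N) - + 2 * I ≡ B + + 2 + + 2 * N - + 2 * I
  shift = solve-∀
  last : ∀ B N → B + + 2 * (+ 1 + N) - + 2 * N ≡ B + + 2
  last = solve-∀
  first : ∀ B N → B + + 2 + + 2 * N ≡ B + + 2 * (+ 1 + N)
  first = solve-∀
  step : ∀ A N → A + + 2 * N + + 2 ≡ A + + 2 * (+ 1 + N)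
  step = solve-∀
  back : ∀ B → B + + 2 + - + 2 ≡ B
  back = solve-∀

summandᶠ : ℤ → ℤ → ℕ → ℕ → Frac
summandᶠ a b c i = q^ (b + + 2 * + c - + 2 * + i) t^ (b + + 2 * + c - + 2 * + i) *ᶠ Hᶠ ((a - b - + 2 * + c + + 4 * + i) ∷ [])

Σ-summandᶠ-≈ : ∀ a b c → Σᶠ c (summandᶠ a b c) ≈ᶠ (q^ a t^ (b + + 2 * + c) +ᶠ -ᶠ q^ (a + + 2 * + c) t^ b) *ᶠ v
Σ-summandᶠ-≈ a b c = begin
  Σᶠ c (summandᶠ a b c)  ≈⟨ Σᶠ-cong summand≈ c ⟩
  Σᶠ c f                 ≈⟨ ≈ᶠ.sym (*-identityʳ (Σᶠ c f)) ⟩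
  Σᶠ c f *ᶠ 1ᶠ           ≈⟨ *ᶠ-cong (≈ᶠ.refl {Σᶠ c f}) (≈ᶠ.sym v-inverse) ⟩
  Σᶠ c f *ᶠ (D *ᶠ v)     ≈⟨ ≈ᶠ.sym (*ᶠ-assoc (Σᶠ c f) D v) ⟩
  (Σᶠ c f *ᶠ D) *ᶠ v     ≈⟨ *ᶠ-cong (geometric c a b) (≈ᶠ.refl {v}) ⟩
  (q^ a t^ (b + + 2 * + c) +ᶠ -ᶠ q^ (a + + 2 * + c) t^ b) *ᶠ v ∎
  where
  open ≈ᶠ-Reasoning
  D = 1ᶠ +ᶠ -ᶠ q^ (+ 2) t^ (- + 2)
  f : ℕ → Frac
  f i = q^ (a + + 2 * + i) t^ (b + + 2 * + c - + 2 * + i)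
  exponent : ∀ a b C I → b + + 2 * C - + 2 * I + (a - b - + 2 * C + + 4 * I) ≡ a + + 2 * I
  exponent = solve-∀
  summand≈ : ∀ i → summandᶠ a b c i ≈ᶠ f i
  summand≈ i = begin
    q^ e t^ e *ᶠ Hᶠ (x ∷ [])       ≈⟨ *ᶠ-cong (≈ᶠ.refl {q^ e t^ e}) (H₂-expansion x) ⟩
    q^ e t^ e *ᶠ (q^ x t^ 0ℤ *ᶠ 1ᶠ) ≈⟨ *ᶠ-cong (≈ᶠ.refl {q^ e t^ e}) (*-identityʳ (q^ x t^ 0ℤ)) ⟩
    q^ e t^ e *ᶠ q^ x t^ 0ℤ         ≈⟨ q^t^-* e e x 0ℤ ⟩
    q^ (e + x) t^ (e + 0ℤ)          ≈⟨ q^t^-cong (exponent a b (+ c) (+ i)) (ℤ.+-identityʳ e) ⟩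
    f i                             ∎
    where
    e = b + + 2 * + c - + 2 * + i
    x = a - b - + 2 * + c + + 4 * + i

qtPow-H₃-≈ : ∀ a b C → q^ C t^ C *ᶠ Hᶠ ((a + C) ∷ (b - C) ∷ []) ≈ᶠ
                        q^ (a + + 2 * b) t^ C *ᶠ u₁ +ᶠ q^ (a + + 2 * C) t^ b *ᶠ u₂
qtPow-H₃-≈ a b C = begin
  Q *ᶠ Hᶠ ((a + C) ∷ (b - C) ∷ [])
    ≈⟨ *ᶠ-cong (≈ᶠ.refl {Q}) (H₃-expansion (a + C) (b - C)) ⟩
  Q *ᶠ (zA *ᶠ u₁ +ᶠ zB *ᶠ u₂)
    ≈⟨ solve 5 (λ Q zA zB u₁ u₂ → Q :* (zA :* u₁ :+ zB :* u₂) := (Q :* zA) :* u₁ :+ (Q :* zB) :* u₂) ≈ᶠ.refl Q zA zB u₁ u₂ ⟩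
  (Q *ᶠ zA) *ᶠ u₁ +ᶠ (Q *ᶠ zB) *ᶠ u₂
    ≈⟨ +ᶠ-cong (*ᶠ-cong (≈ᶠ.trans (q^t^-* C C _ _) (q^t^-cong (lem₁ a b C) (ℤ.+-identityʳ C))) (≈ᶠ.refl {u₁}))
               (*ᶠ-cong (≈ᶠ.trans (q^t^-* C C _ _) (q^t^-cong (lem₂ a C) (lem₃ b C))) (≈ᶠ.refl {u₂})) ⟩
  q^ (a + + 2 * b) t^ C *ᶠ u₁ +ᶠ q^ (a + + 2 * C) t^ b *ᶠ u₂ ∎
  where
  open ≈ᶠ-Reasoning
  open Frac-Solver using (solve; _:=_; _:+_; _:*_)
  Q = q^ C t^ C
  zA = q^ (a + C + + 2 * (b - C)) t^ 0ℤ
  zB = q^ (a + C) t^ (b - C)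
  lem₁ : ∀ a b C → C + (a + C + + 2 * (b - C)) ≡ a + + 2 * b
  lem₁ = solve-∀
  lem₂ : ∀ a C → C + (a + C) ≡ a + + 2 * C
  lem₂ = solve-∀
  lem₃ : ∀ b C → C + (b - C) ≡ b
  lem₃ = solve-∀

H₄-expansion-shifted : ∀ a b C → Hᶠ ((a + + 1) ∷ (b + + 1) ∷ (C - + 1) ∷ []) ≈ᶠ
     q^ (a + + 2 * b + + 3 * C) t^ 0ℤ *ᶠ w₁
  +ᶠ ((q^ (a + + 2 * b) t^ C *ᶠ q^ (+ 3) t^ (- + 1)) *ᶠ w₂
  +ᶠ ((q^ (a + + 2 * C) t^ b *ᶠ q^ (- + 1) t^ (+ 1)) *ᶠ w₃
  +ᶠ (q^ (a + C) t^ (b + C) *ᶠ w₄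
  +ᶠ  (q^ a t^ (b + + 2 * C) *ᶠ q^ (+ 1) t^ (- + 1)) *ᶠ w₅)))
H₄-expansion-shifted a b C = ≈ᶠ.trans (H₄-expansion (a + + 1) (b + + 1) (C - + 1))
  (+ᶠ-cong (*ᶠ-cong (q^t^-cong (ℤ-Solver.solve (a ∷ b ∷ C ∷ [])) refl) (≈ᶠ.refl {w₁}))
  (+ᶠ-cong (*ᶠ-cong (split (ℤ-Solver.solve (a ∷ b ∷ [])) (ℤ-Solver.solve (C ∷ []))) (≈ᶠ.refl {w₂}))
  (+ᶠ-cong (*ᶠ-cong (split (ℤ-Solver.solve (a ∷ C ∷ [])) (ℤ-Solver.solve (b ∷ []))) (≈ᶠ.refl {w₃}))
  (+ᶠ-cong (*ᶠ-cong (q^t^-cong (ℤ-Solver.solve (a ∷ C ∷ [])) (ℤ-Solver.solve (b ∷ C ∷ []))) (≈ᶠ.refl {w₄}))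
           (*ᶠ-cong (split (ℤ-Solver.solve (a ∷ [])) (ℤ-Solver.solve (b ∷ C ∷ []))) (≈ᶠ.refl {w₅}))))))
  where
  split : ∀ {i j k l i′ j′} → i′ ≡ i + k → j′ ≡ j + l → q^ i′ t^ j′ ≈ᶠ q^ i t^ j *ᶠ q^ k t^ l
  split {i} {j} {k} {l} i′≡ j′≡ = ≈ᶠ.trans (q^t^-cong i′≡ j′≡) (≈ᶠ.sym (q^t^-* i j k l))

recursionᶠ : ∀ a b c → Hᶠ (a ∷ b ∷ + c ∷ []) ≈ᶠ
  Hᶠ ((a + + 1) ∷ (b + + 1) ∷ (+ c - + 1) ∷ []) +ᶠ q^ (+ c) t^ (+ c) *ᶠ Hᶠ ((a + + c) ∷ (b - + c) ∷ [])
  +ᶠ Σᶠ c (summandᶠ a b c)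
recursionᶠ a b c = begin
  Hᶠ (a ∷ b ∷ + c ∷ [])
    ≈⟨ H₄-expansion a b (+ c) ⟩
  z₁ *ᶠ w₁ +ᶠ (z₂ *ᶠ w₂ +ᶠ (z₃ *ᶠ w₃ +ᶠ (z₄ *ᶠ w₄ +ᶠ z₅ *ᶠ w₅)))
    ≈⟨ +ᶠ-cong (≈ᶠ.refl {z₁ *ᶠ w₁}) (+ᶠ-cong (*ᶠ-cong (≈ᶠ.refl {z₂}) w₂-split)
         (+ᶠ-cong (*ᶠ-cong (≈ᶠ.refl {z₃}) w₃-split) (+ᶠ-cong (≈ᶠ.refl {z₄ *ᶠ w₄}) (*ᶠ-cong (≈ᶠ.refl {z₅}) w₅-split)))) ⟩
  z₁ *ᶠ w₁ +ᶠ (z₂ *ᶠ (M *ᶠ w₂ +ᶠ u₁) +ᶠ (z₃ *ᶠ (K *ᶠ w₃ +ᶠ u₂ +ᶠ -ᶠ v) +ᶠ (z₄ *ᶠ w₄ +ᶠ z₅ *ᶠ (N *ᶠ w₅ +ᶠ v))))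
    ≈⟨ regroup z₁ z₂ z₃ z₄ z₅ w₁ w₂ w₃ w₄ w₅ M K N u₁ u₂ v ⟩
  (z₁ *ᶠ w₁ +ᶠ ((z₂ *ᶠ M) *ᶠ w₂ +ᶠ ((z₃ *ᶠ K) *ᶠ w₃ +ᶠ (z₄ *ᶠ w₄ +ᶠ (z₅ *ᶠ N) *ᶠ w₅))))
    +ᶠ (z₂ *ᶠ u₁ +ᶠ z₃ *ᶠ u₂) +ᶠ (z₅ +ᶠ -ᶠ z₃) *ᶠ v
    ≈⟨ ≈ᶠ.sym (+ᶠ-cong (+ᶠ-cong (H₄-expansion-shifted a b (+ c)) (qtPow-H₃-≈ a b (+ c))) (Σ-summandᶠ-≈ a b c)) ⟩
  Hᶠ ((a + + 1) ∷ (b + + 1) ∷ (+ c - + 1) ∷ []) +ᶠ q^ (+ c) t^ (+ c) *ᶠ Hᶠ ((a + + c) ∷ (b - + c) ∷ [])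
  +ᶠ Σᶠ c (summandᶠ a b c) ∎
  where
  open ≈ᶠ-Reasoning
  z₁ = q^ (a + + 2 * b + + 3 * + c) t^ 0ℤ
  z₂ = q^ (a + + 2 * b) t^ (+ c)
  z₃ = q^ (a + + 2 * + c) t^ b
  z₄ = q^ (a + + c) t^ (b + + c)
  z₅ = q^ a t^ (b + + 2 * + c)
  M = q^ (+ 3) t^ (- + 1)
  K = q^ (- + 1) t^ (+ 1)
  N = q^ (+ 1) t^ (- + 1)

Σᴿ-cong : ∀ n {f g} → (∀ i → f i ≡ g i) → Σᴿ n f ≡ Σᴿ n g
Σᴿ-cong zero    f≡g = refl
Σᴿ-cong (suc n) f≡g = cong₂ _+ᴿ_ (Σᴿ-cong n f≡g) (f≡g n)

value-Σᶠ : ∀ n f → value (Σᶠ n f) ≡ Σᴿ n (λ i → value (f i))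
value-Σᶠ zero    f = refl
value-Σᶠ (suc n) f = trans (value-+ᶠ (Σᶠ n f) (f n)) (cong (_+ᴿ value (f n)) (value-Σᶠ n f))

-- Stated for arbitrary X and Y, so that H is not unfolded when the recursion is transported
-- to the statement.
value-rhs : ∀ X Y {x y} k n F f → value X ≡ x → value Y ≡ y → (∀ i → value (F i) ≡ f i) →
            value (X +ᶠ q^ k t^ k *ᶠ Y +ᶠ Σᶠ n F) ≡ x +ᴿ qtPow k *ᴿ y +ᴿ Σᴿ n f
value-rhs X Y k n F f refl refl F≡f = trans (value-+ᶠ (X +ᶠ q^ k t^ k *ᶠ Y) (Σᶠ n F)) (cong₂ _+ᴿ_
  (trans (value-+ᶠ X (q^ k t^ k *ᶠ Y)) (cong (value X +ᴿ_) (value-*ᶠ (q^ k t^ k) Y)))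
  (trans (value-Σᶠ n F) (Σᴿ-cong n F≡f)))

lemma2p20 : (a b : ℤ) (c : ℕ) →
    H (a ∷ b ∷ + c ∷ [])
      ≈ᴿ H ((a + + 1) ∷ (b + + 1) ∷ (+ c - + 1) ∷ [])
         +ᴿ qtPow (+ c) *ᴿ H ((a + + c) ∷ (b - + c) ∷ [])
         +ᴿ Σᴿ c (λ i → qtPow (b + + 2 * + c - + 2 * + i) *ᴿ H ((a - b - + 2 * + c + + 4 * + i) ∷ []))
lemma2p20 a b c = subst₂ _≈ᴿ_ (Hᶠ-value (a ∷ b ∷ + c ∷ []))
  (value-rhs (Hᶠ ((a + + 1) ∷ (b + + 1) ∷ (+ c - + 1) ∷ [])) (Hᶠ ((a + + c) ∷ (b - + c) ∷ [])) (+ c) c (summandᶠ a b c)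
             (λ i → qtPow (b + + 2 * + c - + 2 * + i) *ᴿ H ((a - b - + 2 * + c + + 4 * + i) ∷ []))
             (Hᶠ-value ((a + + 1) ∷ (b + + 1) ∷ (+ c - + 1) ∷ [])) (Hᶠ-value ((a + + c) ∷ (b - + c) ∷ []))
             λ i → trans (value-*ᶠ _ (Hᶠ ((a - b - + 2 * + c + + 4 * + i) ∷ [])))
                         (cong (qtPow (b + + 2 * + c - + 2 * + i) *ᴿ_) (Hᶠ-value ((a - b - + 2 * + c + + 4 * + i) ∷ []))))
  (coeff-≡ (value-≃ (recursionᶠ a b c)))
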